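{- Let $r\geq 3$ and $n\ge 16r$. Let $G$ be an $r$-partite graph on $(V_1,\ldots,V_r)$, where $|V_1|=\ldots=|V_r|=n$ and $\hat{\delta}(G)\geq (1-1/(16r))n$. Let $i,j\in [r]$ and let $v,v'\in V_i$ and $u_1,u_2\in V_j$ be distinct vertices with $vu_1,vu_2,v'u_1,v'u_2\in E(G)$. Then there is a function $\psi:\mathcal{K}_{[r]}\to \mathbb{R}$ with $\sum_{K\in\mathcal{K}_{[r]}}\psi(K)=0$ such that: (i) for each $e\in E(G)$, $\sum_{K\in \mathcal{K}_{[r]}:e\in E(K)}\psi(K)$ equals $1$ if $e=vu_1$ or $e=v'u_2$, equals $-1$ if $e=vu_2$ or $e=v'u_1$, and equals $0$ otherwise; (ii) for each $K\in \mathcal{K}_{[r]}$, letting $V=\{v,v',u_1,u_2\}$, we have $|\psi(K)|\leq 2n^2/k_{[r]}$ if $|V(K)\cap V|=2$, and $\psi(K)=0$ otherwise.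
   Context: An $r$-partite graph $G$ on $(V_1,\ldots,V_r)$ has vertex set partitioned into $V_1,\ldots,V_r$ with no edge inside any $V_i$. $d(v,X)$ is the number of neighbours of $v$ in $X$; $\hat{\delta}(G)=\min\{d(v,V_j): j\in[r], v\in V(G)\setminus V_j\}$. $\mathcal{K}_{[r]}$ is the set of $r$-cliques in $G$ and $k_{[r]}=|\mathcal{K}_{[r]}|$. -}

module Defs where

open import Data.Bool using (Bool; true; false; _∧_; _∨_; if_then_else_)
open import Data.Nat as ℕ using (ℕ; zero; suc)
open import Data.Fin as Fin using (Fin)
open import Data.Product using (_×_; _,_; proj₁; proj₂)
open import Data.List using (List; []; _∷_; map; concatMap; filter; length; foldr)
open import Data.Integer using (+_)
open import Data.Rational as ℚ using (ℚ; 0ℚ; 1ℚ; _/_)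
open import Relation.Nullary using (¬_)
open import Relation.Nullary.Decidable using (⌊_⌋)
open import Relation.Binary.PropositionalEquality using (_≡_)

-- Vertices of an r-partite graph with parts V_1..V_r each of size n:
-- vertex (a , x) is the x-th vertex of part V_a.
Vertex : ℕ → ℕ → Set
Vertex r n = Fin r × Fin n

part : ∀ {r n} → Vertex r n → Fin r
part = proj₁

_==_ : ∀ {r n} → Vertex r n → Vertex r n → Bool
(a , x) == (b , y) = ⌊ a Fin.≟ b ⌋ ∧ ⌊ x Fin.≟ y ⌋

record RPartiteGraph (r n : ℕ) : Set where
  field
    adj       : Vertex r n → Vertex r n → Bool
    symmetric : ∀ x y → adj x y ≡ adj y x
    partite   : ∀ x y → part x ≡ part y → adj x y ≡ false
open RPartiteGraph public

allFin : (n : ℕ) → List (Fin n)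
allFin zero = []
allFin (suc n) = Fin.zero ∷ map Fin.suc (allFin n)

count : ∀ {A : Set} → (A → Bool) → List A → ℕ
count p [] = 0
count p (x ∷ xs) = if p x then suc (count p xs) else count p xs

deg : ∀ {r n} → RPartiteGraph r n → Vertex r n → Fin r → ℕ
deg {n = n} G v j = count (λ y → adj G v (j , y)) (allFin n)

-- minimum-degree condition  δ̂(G) ≥ (1 - 1/(16r)) n, written over ℕ as
-- 16 r · d(v,V_j) ≥ (16 r - 1) · n  for every j and every v ∉ V_j
MinPartiteDegree≥ : ∀ {r n} → RPartiteGraph r n → Set
MinPartiteDegree≥ {r} {n} G =
  ∀ (v : Vertex r n) (j : Fin r) → ¬ (part v ≡ j) →
    (16 ℕ.* r ℕ.∸ 1) ℕ.* n ℕ.≤ 16 ℕ.* r ℕ.* deg G v j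

-- A transversal: one vertex from each part, given as a function Fin r → Fin n.
Transversal : ℕ → ℕ → Set
Transversal r n = Fin r → Fin n

allFuns : (r n : ℕ) → List (Transversal r n)
allFuns zero n = (λ ()) ∷ []
allFuns (suc r) n =
  concatMap (λ x → map (λ f → λ { Fin.zero → x ; (Fin.suc i) → f i }) (allFuns r n)) (allFin n)

inK : ∀ {r n} → Transversal r n → Vertex r n → Bool
inK K (a , x) = ⌊ K a Fin.≟ x ⌋

-- every r-clique of an r-partite graph meets each part in exactly one vertex,
-- so r-cliques are exactly the transversals whose vertices are pairwise adjacent.
isCliqueᵇ : ∀ {r n} → RPartiteGraph r n → Transversal r n → Bool
isCliqueᵇ {r} G K =
  foldr _∧_ true
    (concatMap (λ a → map (λ b → ⌊ a Fin.≟ b ⌋ ∨ adj G (a , K a) (b , K b)) (allFin r)) (allFin r))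

-- 𝒦_[r] as a list (without repetition)
cliques : ∀ {r n} → RPartiteGraph r n → List (Transversal r n)
cliques {r} {n} G = filter (λ K → Data.Bool._≟_ (isCliqueᵇ G K) true) (allFuns r n)
  where import Data.Bool

IsClique : ∀ {r n} → RPartiteGraph r n → Transversal r n → Set
IsClique G K = isCliqueᵇ G K ≡ true

kr : ∀ {r n} → RPartiteGraph r n → ℕ
kr G = length (cliques G)

sumℚ : ∀ {A : Set} → (A → ℚ) → List A → ℚ
sumℚ f = foldr (λ a s → f a ℚ.+ s) 0ℚ

ℕtoℚ : ℕ → ℚ
ℕtoℚ m = (+ m) / 1

sameEdge : ∀ {r n} → Vertex r n → Vertex r n → Vertex r n → Vertex r n → Bool
sameEdge x y p q = ((x == p) ∧ (y == q)) ∨ ((x == q) ∧ (y == p))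

-- number of vertices of the list lying in K (used for |V(K) ∩ {v,v',u₁,u₂}|,
-- these four vertices being distinct)
countIn : ∀ {r n} → Transversal r n → List (Vertex r n) → ℕ
countIn K = count (inK K)

module Submission where

open import Defs

import Data.Nat.Properties as ℕP
open import Algebra.Properties.CommutativeSemigroup ℕP.+-commutativeSemigroup using ()
  renaming (interchange to +-interchange)
open import Algebra.Properties.CommutativeSemigroup ℕP.*-commutativeSemigroup using ()
  renaming (x∙yz≈y∙xz to *-leftComm; x∙yz≈z∙yx to *-rotate)
import Data.Bool
open import Data.Bool using (Bool; true; false; _∧_; _∨_; if_then_else_; not)
open import Data.Bool.ListAction using (and; all; or; any)
open import Data.Bool.Properties using (∧-comm; ∧-assoc; ∧-zeroʳ; ∧-identityʳ; ∨-comm; ∨-identityʳ)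
open import Data.Empty using (⊥-elim)
open import Data.Fin as Fin using (Fin)
import Data.Integer as ℤ
import Data.Integer.Properties as ℤP
open import Data.List using (List; []; _∷_; _++_; map; concatMap; filter; length; foldr)
import Data.List.Properties as ListP
open import Data.List.Relation.Unary.All as All using (All)
open import Data.Nat as ℕ using (ℕ; zero; suc; _+_; _*_; _∸_; _≤_; z≤n; s≤s)
open import Data.Nat.Coprimality as Coprime using (1-coprimeTo)
open import Data.Nat.Tactic.RingSolver using () renaming (solve to solve-ℕ)
open import Data.Product using (Σ; _×_; _,_; proj₁; proj₂)
open import Data.Rational as ℚ using (ℚ; mkℚ; 0ℚ; 1ℚ; -_; ∣_∣; toℚᵘ)
import Data.Rational.Properties as ℚP
import Data.Rational.Solver as ℚ-Solver
import Data.Rational.Unnormalised as ℚᵘ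
import Data.Rational.Unnormalised.Properties as ℚᵘP
open import Data.Sum as Sum using (_⊎_; inj₁; inj₂; [_,_]′)
open import Data.Vec.Functional as Vector using (updateAt)
open import Data.Vec.Functional.Properties using (updateAt-updates; updateAt-minimal)
open import Function using (_∘_; id)
open import Relation.Binary.Core using (_Preserves_⟶_)
open import Relation.Binary.PropositionalEquality
  using (_≡_; _≢_; _≗_; refl; sym; trans; cong; cong₂; subst; subst₂; module ≡-Reasoning)
open import Relation.Nullary using (¬_; yes; no)
open import Relation.Nullary.Decidable using (⌊_⌋)

-- Let S be the set of parts other than V_i and V_j, and call a transversal K good when K
-- restricted to S is a clique all of whose vertices are adjacent to v, v', u₁ and u₂. Goodness
-- ignores K i and K j, so for each α ∈ {v, v'} and β ∈ {u₁, u₂} the same number N = #good/n² of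
-- good K have K i = α and K j = β, and every such K is an r-clique. Let ψ be ±1/N on these
-- cliques, with sign + for (v,u₁), (v',u₂) and − for (v,u₂), (v',u₁). For an edge missing V_j
-- (resp. V_i) the four signed counts of cliques through it agree in pairs and cancel; for an edge
-- between V_i and V_j only one of the four families can contain it, which gives the values ±1, 0.
-- For the bound, resample one coordinate at a time: by the minimum-degree condition a vertex
-- outside V_l excludes at most n/(16r) choices of K l. Hence at most 4/15 of the S-cliques are
-- not good, and k_[r] ≤ #(S-cliques) ≤ 2·#good = 2n²N, i.e. |ψ| ≤ 1/N ≤ 2n²/k_[r].

false≢true : false ≢ true
false≢true ()

∧-swap : ∀ x y z → x ∧ y ∧ z ≡ y ∧ x ∧ z
∧-swap true y z = refl
∧-swap false y z = sym (∧-zeroʳ y)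

1≤m*n⇒1≤n : ∀ m {n} → 1 ≤ m * n → 1 ≤ n
1≤m*n⇒1≤n m {zero} 1≤m*0 with () ← ℕP.≤-trans 1≤m*0 (ℕP.≤-reflexive (ℕP.*-zeroʳ m))
1≤m*n⇒1≤n m {suc n} _ = s≤s z≤n

15b≤4[a+b]⇒a+b≤2a : ∀ a b → 15 * b ≤ 4 * (a + b) → a + b ≤ 2 * a
15b≤4[a+b]⇒a+b≤2a a b 15b≤4[a+b] = begin
  a + b   ≤⟨ ℕP.+-monoʳ-≤ a b≤a ⟩
  a + a   ≡⟨ solve-ℕ (a ∷ []) ⟩
  2 * a   ∎
  where
  open ℕP.≤-Reasoning
  11b≤4a : 11 * b ≤ 4 * a
  11b≤4a = ℕP.+-cancelʳ-≤ (4 * b) (11 * b) (4 * a) (begin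
    11 * b + 4 * b  ≡⟨ solve-ℕ (b ∷ []) ⟩
    15 * b          ≤⟨ 15b≤4[a+b] ⟩
    4 * (a + b)     ≡⟨ ℕP.*-distribˡ-+ 4 a b ⟩
    4 * a + 4 * b   ∎)
  b≤a : b ≤ a
  b≤a = ℕP.*-cancelˡ-≤ 11 (ℕP.≤-trans 11b≤4a (ℕP.*-monoˡ-≤ a (ℕP.m≤m+n 4 7)))

guarded-cong : ∀ s {u v} → (s ≡ true → u ≡ v) → not s ∨ u ≡ not s ∨ v
guarded-cong true u≡v = u≡v refl
guarded-cong false u≡v = refl

all-cong : ∀ {A : Set} {p q : A → Bool} (xs : List A) → p ≗ q → all p xs ≡ all q xs
all-cong xs p≗q = cong and (ListP.map-cong p≗q xs)

∧-true⁻ : ∀ {x y} → x ∧ y ≡ true → x ≡ true × y ≡ true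
∧-true⁻ {true} y≡true = refl , y≡true

∨-true⁻ : ∀ {x y} → x ∨ y ≡ true → x ≡ false → y ≡ true
∨-true⁻ {false} y≡true refl = y≡true

∨-true⇒⊎ : ∀ {x y} → x ∨ y ≡ true → x ≡ true ⊎ y ≡ true
∨-true⇒⊎ {true} _ = inj₁ refl
∨-true⇒⊎ {false} y≡true = inj₂ y≡true

-- Sums and counts over lists

ind : Bool → ℕ
ind true = 1
ind false = 0

sumℕ : {A : Set} → (A → ℕ) → List A → ℕ
sumℕ f = foldr (λ a s → f a + s) 0

module _ {A : Set} where

  count-as-sumℕ : (p : A → Bool) (xs : List A) → count p xs ≡ sumℕ (ind ∘ p) xs
  count-as-sumℕ p [] = refl
  count-as-sumℕ p (x ∷ xs) with p x
  ... | true = cong suc (count-as-sumℕ p xs)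
  ... | false = count-as-sumℕ p xs

  sumℕ-cong : {f g : A → ℕ} (xs : List A) → f ≗ g → sumℕ f xs ≡ sumℕ g xs
  sumℕ-cong [] f≗g = refl
  sumℕ-cong (x ∷ xs) f≗g = cong₂ _+_ (f≗g x) (sumℕ-cong xs f≗g)

  sumℕ-mono : {f g : A → ℕ} (xs : List A) → (∀ x → f x ≤ g x) → sumℕ f xs ≤ sumℕ g xs
  sumℕ-mono [] f≤g = z≤n
  sumℕ-mono (x ∷ xs) f≤g = ℕP.+-mono-≤ (f≤g x) (sumℕ-mono xs f≤g)

  sumℕ-++ : (f : A → ℕ) (xs ys : List A) → sumℕ f (xs ++ ys) ≡ sumℕ f xs + sumℕ f ys
  sumℕ-++ f [] ys = refl
  sumℕ-++ f (x ∷ xs) ys = trans (cong (f x +_) (sumℕ-++ f xs ys)) (sym (ℕP.+-assoc (f x) _ _))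

  sumℕ-+ : (f g : A → ℕ) (xs : List A) → sumℕ (λ x → f x + g x) xs ≡ sumℕ f xs + sumℕ g xs
  sumℕ-+ f g [] = refl
  sumℕ-+ f g (x ∷ xs) rewrite sumℕ-+ f g xs = +-interchange (f x) (g x) (sumℕ f xs) (sumℕ g xs)

  sumℕ-*ˡ : (c : ℕ) (f : A → ℕ) (xs : List A) → sumℕ (λ x → c * f x) xs ≡ c * sumℕ f xs
  sumℕ-*ˡ c f [] = sym (ℕP.*-zeroʳ c)
  sumℕ-*ˡ c f (x ∷ xs) = trans (cong (c * f x +_) (sumℕ-*ˡ c f xs)) (sym (ℕP.*-distribˡ-+ c (f x) _))

  sumℕ-const : (c : ℕ) (xs : List A) → sumℕ (λ _ → c) xs ≡ length xs * c
  sumℕ-const c [] = refl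
  sumℕ-const c (x ∷ xs) = cong (c +_) (sumℕ-const c xs)

  sumℕ-zero : (xs : List A) → sumℕ (λ _ → 0) xs ≡ 0
  sumℕ-zero xs = trans (sumℕ-const 0 xs) (ℕP.*-zeroʳ (length xs))

  sumℕ-bound : (f : A → ℕ) (c B : ℕ) (xs : List A) → All (λ x → c * f x ≤ B) xs → c * sumℕ f xs ≤ length xs * B
  sumℕ-bound f c B [] All.[] = ℕP.≤-reflexive (ℕP.*-zeroʳ c)
  sumℕ-bound f c B (x ∷ xs) (fx≤B All.∷ bounds) = begin
    c * (f x + sumℕ f xs)       ≡⟨ ℕP.*-distribˡ-+ c (f x) _ ⟩
    c * f x + c * sumℕ f xs     ≤⟨ ℕP.+-mono-≤ fx≤B (sumℕ-bound f c B xs bounds) ⟩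
    B + length xs * B           ∎
    where open ℕP.≤-Reasoning

  count-cong : {p q : A → Bool} (xs : List A) → p ≗ q → count p xs ≡ count q xs
  count-cong {p} {q} xs p≗q = begin
    count p xs          ≡⟨ count-as-sumℕ p xs ⟩
    sumℕ (ind ∘ p) xs   ≡⟨ sumℕ-cong xs (cong ind ∘ p≗q) ⟩
    sumℕ (ind ∘ q) xs   ≡⟨ count-as-sumℕ q xs ⟨
    count q xs          ∎
    where open ≡-Reasoning

  count-mono : {p q : A → Bool} (xs : List A) → (∀ x → p x ≡ true → q x ≡ true) → count p xs ≤ count q xs
  count-mono [] p⇒q = z≤n
  count-mono {p} {q} (x ∷ xs) p⇒q with p x in px | q x in qx
  ... | true  | true  = s≤s (count-mono xs p⇒q)
  ... | true  | false with () ← trans (sym qx) (p⇒q x px)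
  ... | false | true  = ℕP.m≤n⇒m≤1+n (count-mono xs p⇒q)
  ... | false | false = count-mono xs p⇒q

  count-false : (xs : List A) → count (λ _ → false) xs ≡ 0
  count-false [] = refl
  count-false (x ∷ xs) = count-false xs

  count-*ʳ : (p : A → Bool) (c : ℕ) (xs : List A) → sumℕ (λ x → ind (p x) * c) xs ≡ count p xs * c
  count-*ʳ p c [] = refl
  count-*ʳ p c (x ∷ xs) with p x
  ... | true = cong₂ _+_ (ℕP.+-identityʳ c) (count-*ʳ p c xs)
  ... | false = count-*ʳ p c xs

  count-∧-const : (p : A → Bool) (c : Bool) (xs : List A) → count (λ x → p x ∧ c) xs ≡ ind c * count p xs
  count-∧-const p true xs = trans (count-cong xs (∧-identityʳ ∘ p)) (sym (ℕP.+-identityʳ _))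
  count-∧-const p false xs = trans (count-cong xs (∧-zeroʳ ∘ p)) (count-false xs)

  count-true : (xs : List A) → count (λ _ → true) xs ≡ length xs
  count-true [] = refl
  count-true (x ∷ xs) = cong suc (count-true xs)

  count-∧-split : (p q : A → Bool) (xs : List A) →
    count p xs ≡ count (λ x → p x ∧ q x) xs + count (λ x → p x ∧ not (q x)) xs
  count-∧-split p q [] = refl
  count-∧-split p q (x ∷ xs) with p x | q x
  ... | true  | true  = cong suc (count-∧-split p q xs)
  ... | true  | false = trans (cong suc (count-∧-split p q xs)) (sym (ℕP.+-suc _ _))
  ... | false | _     = count-∧-split p q xs

  count-∨ : (p q : A → Bool) (xs : List A) → count (λ x → p x ∨ q x) xs ≤ count p xs + count q xs
  count-∨ p q [] = z≤n
  count-∨ p q (x ∷ xs) with p x | q x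
  ... | true  | true  = s≤s (ℕP.≤-trans (count-∨ p q xs) (ℕP.+-monoʳ-≤ (count p xs) (ℕP.n≤1+n _)))
  ... | true  | false = s≤s (count-∨ p q xs)
  ... | false | true  = ℕP.≤-trans (s≤s (count-∨ p q xs)) (ℕP.≤-reflexive (sym (ℕP.+-suc _ _)))
  ... | false | false = count-∨ p q xs

  count-+-count-not : (p : A → Bool) (xs : List A) → count p xs + count (not ∘ p) xs ≡ length xs
  count-+-count-not p [] = refl
  count-+-count-not p (x ∷ xs) with p x
  ... | true  = cong suc (count-+-count-not p xs)
  ... | false = trans (ℕP.+-suc _ _) (cong suc (count-+-count-not p xs))

  length-filter-true : (p : A → Bool) (xs : List A) →
    length (filter (λ x → Data.Bool._≟_ (p x) true) xs) ≡ count p xs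
  length-filter-true p [] = refl
  length-filter-true p (x ∷ xs) with p x
  ... | true  = cong suc (length-filter-true p xs)
  ... | false = length-filter-true p xs

module _ {A B : Set} where

  sumℕ-map : (f : B → ℕ) (g : A → B) (xs : List A) → sumℕ f (map g xs) ≡ sumℕ (f ∘ g) xs
  sumℕ-map f g [] = refl
  sumℕ-map f g (x ∷ xs) = cong (f (g x) +_) (sumℕ-map f g xs)

  sumℕ-concatMap : (f : B → ℕ) (g : A → List B) (xs : List A) →
    sumℕ f (concatMap g xs) ≡ sumℕ (λ x → sumℕ f (g x)) xs
  sumℕ-concatMap f g [] = refl
  sumℕ-concatMap f g (x ∷ xs) =
    trans (sumℕ-++ f (g x) (concatMap g xs)) (cong (sumℕ f (g x) +_) (sumℕ-concatMap f g xs))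

  sumℕ-comm : (f : A → B → ℕ) (xs : List A) (ys : List B) →
    sumℕ (λ x → sumℕ (f x) ys) xs ≡ sumℕ (λ y → sumℕ (λ x → f x y) xs) ys
  sumℕ-comm f [] ys = sym (sumℕ-zero ys)
  sumℕ-comm f (x ∷ xs) ys = trans (cong (sumℕ (f x) ys +_) (sumℕ-comm f xs ys))
    (sym (sumℕ-+ (f x) (λ y → sumℕ (λ x' → f x' y) xs) ys))

  count-not-all : (p : A → Bool) (q : A → B → Bool) (xs : List A) (ys : List B) →
    count (λ x → p x ∧ not (all (q x) ys)) xs ≤ sumℕ (λ y → count (λ x → p x ∧ not (q x y)) xs) ys
  count-not-all p q xs [] = ℕP.≤-reflexive (trans (count-cong xs (λ x → ∧-zeroʳ (p x))) (count-false xs))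
  count-not-all p q xs (y ∷ ys) = begin
    count (λ x → p x ∧ not (q x y ∧ all (q x) ys)) xs
      ≡⟨ count-cong xs (λ x → ∧-not-∧ (p x) (q x y) (all (q x) ys)) ⟩
    count (λ x → (p x ∧ not (q x y)) ∨ (p x ∧ not (all (q x) ys))) xs
      ≤⟨ count-∨ _ _ xs ⟩
    count (λ x → p x ∧ not (q x y)) xs + count (λ x → p x ∧ not (all (q x) ys)) xs
      ≤⟨ ℕP.+-monoʳ-≤ _ (count-not-all p q xs ys) ⟩
    count (λ x → p x ∧ not (q x y)) xs + sumℕ (λ y → count (λ x → p x ∧ not (q x y)) xs) ys ∎
    where
    open ℕP.≤-Reasoning
    ∧-not-∧ : ∀ a b c → a ∧ not (b ∧ c) ≡ (a ∧ not b) ∨ (a ∧ not c)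
    ∧-not-∧ true true c = refl
    ∧-not-∧ true false c = refl
    ∧-not-∧ false b c = refl

-- Enumerations

module _ {n : ℕ} where

  ⌊≟⌋-diag : (x : Fin n) → ⌊ x Fin.≟ x ⌋ ≡ true
  ⌊≟⌋-diag x with x Fin.≟ x
  ... | yes _ = refl
  ... | no x≢x = ⊥-elim (x≢x refl)

  ⌊≟⌋-≢ : {x y : Fin n} → x ≢ y → ⌊ x Fin.≟ y ⌋ ≡ false
  ⌊≟⌋-≢ {x} {y} x≢y with x Fin.≟ y
  ... | yes x≡y = ⊥-elim (x≢y x≡y)
  ... | no _ = refl

  ⌊≟⌋⇒≡ : {x y : Fin n} → ⌊ x Fin.≟ y ⌋ ≡ true → x ≡ y
  ⌊≟⌋⇒≡ {x} {y} eq with x Fin.≟ y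
  ... | yes x≡y = x≡y

  ⌊≟⌋∨⌊≟⌋⇒ : ∀ {x y z : Fin n} → ⌊ x Fin.≟ y ⌋ ∨ ⌊ x Fin.≟ z ⌋ ≡ true → x ≡ y ⊎ x ≡ z
  ⌊≟⌋∨⌊≟⌋⇒ {x} {y} {z} either with x Fin.≟ y
  ... | yes x≡y = inj₁ x≡y
  ... | no _ = inj₂ (⌊≟⌋⇒≡ either)

  ⌊≟⌋-exclusive : ∀ {y z : Fin n} → y ≢ z → ∀ x → ⌊ x Fin.≟ y ⌋ ∧ ⌊ x Fin.≟ z ⌋ ≡ false
  ⌊≟⌋-exclusive {y} y≢z x with x Fin.≟ y
  ... | yes refl = ⌊≟⌋-≢ y≢z
  ... | no _ = refl

  ⌊≟⌋-sym : (x y : Fin n) → ⌊ x Fin.≟ y ⌋ ≡ ⌊ y Fin.≟ x ⌋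
  ⌊≟⌋-sym x y with y Fin.≟ x
  ... | yes refl = ⌊≟⌋-diag x
  ... | no y≢x = ⌊≟⌋-≢ (y≢x ∘ sym)

⌊≟⌋-suc : ∀ {n} (x y : Fin n) → ⌊ Fin.suc x Fin.≟ Fin.suc y ⌋ ≡ ⌊ x Fin.≟ y ⌋
⌊≟⌋-suc x y with x Fin.≟ y
... | yes _ = refl
... | no _ = refl

length-allFin : ∀ n → length (allFin n) ≡ n
length-allFin zero = refl
length-allFin (suc n) = cong suc (trans (ListP.length-map Fin.suc (allFin n)) (length-allFin n))

all-map : ∀ {A B : Set} (p : B → Bool) (g : A → B) (xs : List A) → all p (map g xs) ≡ all (p ∘ g) xs
all-map p g xs = cong and (sym (ListP.map-∘ xs))

and-concatMap : ∀ {A : Set} (f : A → List Bool) (xs : List A) → and (concatMap f xs) ≡ all (and ∘ f) xs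
and-concatMap f [] = refl
and-concatMap f (x ∷ xs) = trans (and-++ (f x)) (cong (and (f x) ∧_) (and-concatMap f xs))
  where
  and-++ : ∀ bs {cs} → and (bs ++ cs) ≡ and bs ∧ and cs
  and-++ [] = refl
  and-++ (b ∷ bs) = trans (cong (b ∧_) (and-++ bs)) (sym (∧-assoc b _ _))

all-allFin⁺ : ∀ {n} (p : Fin n → Bool) → (∀ x → p x ≡ true) → all p (allFin n) ≡ true
all-allFin⁺ {zero} p p-true = refl
all-allFin⁺ {suc n} p p-true rewrite p-true Fin.zero =
  trans (all-map p Fin.suc (allFin n)) (all-allFin⁺ (p ∘ Fin.suc) (p-true ∘ Fin.suc))

all-allFin⁻ : ∀ {n} (p : Fin n → Bool) → all p (allFin n) ≡ true → ∀ x → p x ≡ true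
all-allFin⁻ {suc n} p all-p x with p Fin.zero in p0
all-allFin⁻ {suc n} p all-p Fin.zero    | true = p0
all-allFin⁻ {suc n} p all-p (Fin.suc x) | true =
  all-allFin⁻ (p ∘ Fin.suc) (trans (sym (all-map p Fin.suc (allFin n))) all-p) x

sumℕ-allFin-pin : ∀ {n} (β : Fin n) (g : Fin n → Bool) →
  sumℕ (λ x → ind (⌊ x Fin.≟ β ⌋ ∧ g x)) (allFin n) ≡ ind (g β)
sumℕ-allFin-pin {suc n} Fin.zero g = begin
  ind (g Fin.zero) + sumℕ _ (map Fin.suc (allFin n))  ≡⟨ cong (ind (g Fin.zero) +_) (sumℕ-map _ Fin.suc (allFin n)) ⟩
  ind (g Fin.zero) + sumℕ (λ _ → 0) (allFin n)       ≡⟨ cong (ind (g Fin.zero) +_) (sumℕ-zero (allFin n)) ⟩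
  ind (g Fin.zero) + 0                                ≡⟨ ℕP.+-identityʳ _ ⟩
  ind (g Fin.zero)                                    ∎
  where open ≡-Reasoning
sumℕ-allFin-pin {suc n} (Fin.suc β) g = begin
  sumℕ _ (map Fin.suc (allFin n))
    ≡⟨ sumℕ-map _ Fin.suc (allFin n) ⟩
  sumℕ (λ x → ind (⌊ Fin.suc x Fin.≟ Fin.suc β ⌋ ∧ g (Fin.suc x))) (allFin n)
    ≡⟨ sumℕ-cong (allFin n) (λ x → cong (λ b → ind (b ∧ g (Fin.suc x))) (⌊≟⌋-suc x β)) ⟩
  sumℕ (λ x → ind (⌊ x Fin.≟ β ⌋ ∧ g (Fin.suc x))) (allFin n)
    ≡⟨ sumℕ-allFin-pin β (g ∘ Fin.suc) ⟩
  ind (g (Fin.suc β)) ∎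
  where open ≡-Reasoning

any-allFin : ∀ {n} (m : Fin n) → any (λ l → ⌊ m Fin.≟ l ⌋) (allFin n) ≡ true
any-allFin {suc n} Fin.zero = refl
any-allFin {suc n} (Fin.suc m) = begin
  or (map (λ l → ⌊ Fin.suc m Fin.≟ l ⌋) (map Fin.suc (allFin n))) ≡⟨ cong or (ListP.map-∘ (allFin n)) ⟨
  any (λ l → ⌊ Fin.suc m Fin.≟ Fin.suc l ⌋) (allFin n)          ≡⟨ cong or (ListP.map-cong (⌊≟⌋-suc m) (allFin n)) ⟩
  any (λ l → ⌊ m Fin.≟ l ⌋) (allFin n)                          ≡⟨ any-allFin m ⟩
  true                                                          ∎
  where open ≡-Reasoning

length-allFuns-pos : ∀ r n → 1 ≤ n → 1 ≤ length (allFuns r n)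
length-allFuns-pos zero n 1≤n = s≤s z≤n
length-allFuns-pos (suc r) (suc n) 1≤n = begin
  1                                                 ≤⟨ length-allFuns-pos r (suc n) 1≤n ⟩
  length (allFuns r (suc n))                        ≡⟨ ListP.length-map _ (allFuns r (suc n)) ⟨
  length (map _ (allFuns r (suc n)))                ≤⟨ ℕP.m≤m+n _ _ ⟩
  length (map _ (allFuns r (suc n))) + length rest  ≡⟨ ListP.length-++ (map _ (allFuns r (suc n))) ⟨
  length (allFuns (suc r) (suc n))                  ∎
  where
  open ℕP.≤-Reasoning
  rest = concatMap _ (map Fin.suc (allFin n))

-- Transversals

_[_]≔_ : ∀ {r n} → Transversal r n → Fin r → Fin n → Transversal r n
K [ l ]≔ x = updateAt K l (λ _ → x)

Ignores : ∀ {r n} → Fin r → (Transversal r n → Bool) → Set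
Ignores {r} {n} l F = ∀ (K : Transversal r n) x → F (K [ l ]≔ x) ≡ F K

-- allFuns builds transversals from pattern lambdas; lacking function extensionality,
-- summands must respect pointwise equality.
Extensional : ∀ {r n} {B : Set} → (Transversal r n → B) → Set
Extensional f = f Preserves _≗_ ⟶ _≡_

module _ {r n : ℕ} where

  []≔-cong : ∀ {K K' : Transversal r n} l x → K ≗ K' → K [ l ]≔ x ≗ K' [ l ]≔ x
  []≔-cong {K} {K'} l x K≗K' m with m Fin.≟ l
  ... | yes refl = trans (updateAt-updates l K) (sym (updateAt-updates l K'))
  ... | no m≢l = trans (updateAt-minimal m l K m≢l) (trans (K≗K' m) (sym (updateAt-minimal m l K' m≢l)))

  []≔-ext : ∀ {B : Set} {f : Transversal r n → B} l x → Extensional f → Extensional (λ K → f (K [ l ]≔ x))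
  []≔-ext l x f-ext K≗K' = f-ext ([]≔-cong l x K≗K')

  sumℕ-allFuns-suc : (f : Transversal (suc r) n → ℕ) → Extensional f →
    sumℕ f (allFuns (suc r) n) ≡ sumℕ (λ x → sumℕ (λ Q → f (x Vector.∷ Q)) (allFuns r n)) (allFin n)
  sumℕ-allFuns-suc f f-ext = trans (sumℕ-concatMap f _ (allFin n))
    (sumℕ-cong (allFin n) λ x → trans (sumℕ-map f _ (allFuns r n))
      (sumℕ-cong (allFuns r n) λ Q → f-ext λ { Fin.zero → refl ; (Fin.suc m) → refl }))

  ∷-[zero]≔ : ∀ y (Q : Transversal r n) x → (y Vector.∷ Q) [ Fin.zero ]≔ x ≗ x Vector.∷ Q
  ∷-[zero]≔ y Q x Fin.zero = refl
  ∷-[zero]≔ y Q x (Fin.suc m) = refl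

  ∷-[suc]≔ : ∀ y (Q : Transversal r n) l x → (y Vector.∷ Q) [ Fin.suc l ]≔ x ≗ y Vector.∷ (Q [ l ]≔ x)
  ∷-[suc]≔ y Q l x Fin.zero = refl
  ∷-[suc]≔ y Q l x (Fin.suc m) = refl

  ∷-ext : ∀ {B : Set} {f : Transversal (suc r) n → B} y → Extensional f → Extensional (λ Q → f (y Vector.∷ Q))
  ∷-ext y f-ext Q≗Q' = f-ext λ { Fin.zero → refl ; (Fin.suc m) → Q≗Q' m }

sumℕ-resample : ∀ {r n} (l : Fin r) (f : Transversal r n → ℕ) → Extensional f →
  sumℕ (λ K → sumℕ (λ x → f (K [ l ]≔ x)) (allFin n)) (allFuns r n) ≡ n * sumℕ f (allFuns r n)
sumℕ-resample {suc r} {n} Fin.zero f f-ext = begin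
  sumℕ (λ K → sumℕ (λ x → f (K [ Fin.zero ]≔ x)) (allFin n)) (allFuns (suc r) n)
    ≡⟨ sumℕ-allFuns-suc _ (λ K≗K' → sumℕ-cong (allFin n) λ x → []≔-ext Fin.zero x f-ext K≗K') ⟩
  sumℕ (λ y → sumℕ (λ Q → sumℕ (λ x → f ((y Vector.∷ Q) [ Fin.zero ]≔ x)) (allFin n)) (allFuns r n)) (allFin n)
    ≡⟨ sumℕ-cong (allFin n) (λ y → sumℕ-cong (allFuns r n) λ Q → sumℕ-cong (allFin n) λ x → f-ext (∷-[zero]≔ y Q x)) ⟩
  sumℕ (λ _ → sumℕ (λ Q → sumℕ (λ x → f (x Vector.∷ Q)) (allFin n)) (allFuns r n)) (allFin n)
    ≡⟨ sumℕ-const _ (allFin n) ⟩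
  length (allFin n) * sumℕ (λ Q → sumℕ (λ x → f (x Vector.∷ Q)) (allFin n)) (allFuns r n)
    ≡⟨ cong₂ _*_ (length-allFin n) (sumℕ-comm (λ Q x → f (x Vector.∷ Q)) (allFuns r n) (allFin n)) ⟩
  n * sumℕ (λ x → sumℕ (λ Q → f (x Vector.∷ Q)) (allFuns r n)) (allFin n)
    ≡⟨ cong (n *_) (sumℕ-allFuns-suc f f-ext) ⟨
  n * sumℕ f (allFuns (suc r) n) ∎
  where open ≡-Reasoning
sumℕ-resample {suc r} {n} (Fin.suc l) f f-ext = begin
  sumℕ (λ K → sumℕ (λ x → f (K [ Fin.suc l ]≔ x)) (allFin n)) (allFuns (suc r) n)
    ≡⟨ sumℕ-allFuns-suc _ (λ K≗K' → sumℕ-cong (allFin n) λ x → []≔-ext (Fin.suc l) x f-ext K≗K') ⟩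
  sumℕ (λ y → sumℕ (λ Q → sumℕ (λ x → f ((y Vector.∷ Q) [ Fin.suc l ]≔ x)) (allFin n)) (allFuns r n)) (allFin n)
    ≡⟨ sumℕ-cong (allFin n) (λ y → sumℕ-cong (allFuns r n) λ Q → sumℕ-cong (allFin n) λ x → f-ext (∷-[suc]≔ y Q l x)) ⟩
  sumℕ (λ y → sumℕ (λ Q → sumℕ (λ x → f (y Vector.∷ (Q [ l ]≔ x))) (allFin n)) (allFuns r n)) (allFin n)
    ≡⟨ sumℕ-cong (allFin n) (λ y → sumℕ-resample l (λ Q → f (y Vector.∷ Q)) (∷-ext y f-ext)) ⟩
  sumℕ (λ y → n * sumℕ (λ Q → f (y Vector.∷ Q)) (allFuns r n)) (allFin n)
    ≡⟨ sumℕ-*ˡ n _ (allFin n) ⟩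
  n * sumℕ (λ y → sumℕ (λ Q → f (y Vector.∷ Q)) (allFuns r n)) (allFin n)
    ≡⟨ cong (n *_) (sumℕ-allFuns-suc f f-ext) ⟨
  n * sumℕ f (allFuns (suc r) n) ∎
  where open ≡-Reasoning

count-resample : ∀ {r n} (l : Fin r) (F : Transversal r n → Bool) → Extensional F →
  sumℕ (λ K → count (λ x → F (K [ l ]≔ x)) (allFin n)) (allFuns r n) ≡ n * count F (allFuns r n)
count-resample {r} {n} l F F-ext = begin
  sumℕ (λ K → count (λ x → F (K [ l ]≔ x)) (allFin n)) (allFuns r n)
    ≡⟨ sumℕ-cong (allFuns r n) (λ K → count-as-sumℕ _ (allFin n)) ⟩
  sumℕ (λ K → sumℕ (λ x → ind (F (K [ l ]≔ x))) (allFin n)) (allFuns r n)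
    ≡⟨ sumℕ-resample l (ind ∘ F) (cong ind ∘ F-ext) ⟩
  n * sumℕ (ind ∘ F) (allFuns r n)
    ≡⟨ cong (n *_) (count-as-sumℕ F (allFuns r n)) ⟨
  n * count F (allFuns r n) ∎
  where open ≡-Reasoning

count-pin : ∀ {r n} (l : Fin r) (α : Fin n) (F : Transversal r n → Bool) → Extensional F → Ignores l F →
  n * count (λ K → ⌊ K l Fin.≟ α ⌋ ∧ F K) (allFuns r n) ≡ count F (allFuns r n)
count-pin {r} {n} l α F F-ext F-ign = begin
  n * count pinned (allFuns r n)
    ≡⟨ cong (n *_) (count-as-sumℕ pinned (allFuns r n)) ⟩
  n * sumℕ (ind ∘ pinned) (allFuns r n)
    ≡⟨ sumℕ-resample l (ind ∘ pinned) (λ K≗K' → cong₂ (λ u b → ind (⌊ u Fin.≟ α ⌋ ∧ b)) (K≗K' l) (F-ext K≗K')) ⟨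
  sumℕ (λ K → sumℕ (λ x → ind (pinned (K [ l ]≔ x))) (allFin n)) (allFuns r n)
    ≡⟨ sumℕ-cong (allFuns r n) (λ K → sumℕ-cong (allFin n) λ x →
         cong₂ (λ u b → ind (⌊ u Fin.≟ α ⌋ ∧ b)) (updateAt-updates l K) (F-ign K x)) ⟩
  sumℕ (λ K → sumℕ (λ x → ind (⌊ x Fin.≟ α ⌋ ∧ F K)) (allFin n)) (allFuns r n)
    ≡⟨ sumℕ-cong (allFuns r n) (λ K → sumℕ-allFin-pin α (λ _ → F K)) ⟩
  sumℕ (ind ∘ F) (allFuns r n)
    ≡⟨ count-as-sumℕ F (allFuns r n) ⟨
  count F (allFuns r n) ∎
  where
  open ≡-Reasoning
  pinned : Transversal r n → Bool
  pinned K = ⌊ K l Fin.≟ α ⌋ ∧ F K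

-- Partial cliques

module PartialCliques {r n : ℕ} (G : RPartiteGraph r n) where

  cliqueOnᵇ : (Fin r → Bool) → Transversal r n → Bool
  cliqueOnᵇ S K = all (λ m → all (λ m' →
    not (S m) ∨ not (S m') ∨ ⌊ m Fin.≟ m' ⌋ ∨ adj G (m , K m) (m' , K m')) (allFin r)) (allFin r)

  CliqueOn : (Fin r → Bool) → Transversal r n → Set
  CliqueOn S K = ∀ m m' → S m ≡ true → S m' ≡ true → m ≢ m' → adj G (m , K m) (m' , K m') ≡ true

  cliqueOnᵇ⇒ : ∀ S K → cliqueOnᵇ S K ≡ true → CliqueOn S K
  cliqueOnᵇ⇒ S K isClique m m' Sm Sm' m≢m'
    with all-allFin⁻ _ (all-allFin⁻ _ isClique m) m'
  ... | adjacent rewrite Sm | Sm' | ⌊≟⌋-≢ m≢m' = adjacent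

  cliqueOnᵇ⇐ : ∀ S K → CliqueOn S K → cliqueOnᵇ S K ≡ true
  cliqueOnᵇ⇐ S K clique = all-allFin⁺ _ λ m → all-allFin⁺ _ λ m' → pair m m'
    where
    pair : ∀ m m' → (not (S m) ∨ not (S m') ∨ ⌊ m Fin.≟ m' ⌋ ∨ adj G (m , K m) (m' , K m')) ≡ true
    pair m m' with S m in Sm | S m' in Sm' | m Fin.≟ m'
    ... | false | _     | _         = refl
    ... | true  | false | _         = refl
    ... | true  | true  | yes _     = refl
    ... | true  | true  | no m≢m'   = clique m m' Sm Sm' m≢m'

  cliqueOnᵇ-cong : ∀ S {K K'} → (∀ m → S m ≡ true → K m ≡ K' m) → cliqueOnᵇ S K ≡ cliqueOnᵇ S K'
  cliqueOnᵇ-cong S K≡K'-on-S = all-cong (allFin r) λ m → all-cong (allFin r) λ m' →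
    guarded-cong (S m) λ Sm → guarded-cong (S m') λ Sm' →
      cong₂ (λ u v → ⌊ m Fin.≟ m' ⌋ ∨ adj G (m , u) (m' , v)) (K≡K'-on-S m Sm) (K≡K'-on-S m' Sm')

  cliqueOnᵇ-ext : ∀ S → Extensional (cliqueOnᵇ S)
  cliqueOnᵇ-ext S K≗K' = cliqueOnᵇ-cong S (λ m _ → K≗K' m)

  []≔-agrees-on : ∀ (S : Fin r → Bool) l → S l ≡ false →
    ∀ (K : Transversal r n) x m → S m ≡ true → (K [ l ]≔ x) m ≡ K m
  []≔-agrees-on S l Sl K x m Sm = updateAt-minimal m l K λ { refl → false≢true (trans (sym Sl) Sm) }

  cliqueOnᵇ-ignores : ∀ S l → S l ≡ false → Ignores l (cliqueOnᵇ S)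
  cliqueOnᵇ-ignores S l Sl K x = cliqueOnᵇ-cong S ([]≔-agrees-on S l Sl K x)

  CliqueOn-mono : ∀ {S S'} K → (∀ m → S' m ≡ true → S m ≡ true) → CliqueOn S K → CliqueOn S' K
  CliqueOn-mono K S'⊆S clique m m' S'm S'm' = clique m m' (S'⊆S m S'm) (S'⊆S m' S'm')

  insert : (Fin r → Bool) → Fin r → Fin r → Bool
  insert S l m = ⌊ m Fin.≟ l ⌋ ∨ S m

  CliqueOn-insert : ∀ S l K → CliqueOn S K →
    (∀ m → S m ≡ true → m ≢ l → adj G (m , K m) (l , K l) ≡ true) → CliqueOn (insert S l) K
  CliqueOn-insert S l K clique adj-l m m' Sm Sm' m≢m' with m Fin.≟ l | m' Fin.≟ l
  ... | yes refl | yes refl = ⊥-elim (m≢m' refl)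
  ... | yes refl | no m'≢l = trans (symmetric G _ _) (adj-l m' Sm' m'≢l)
  ... | no m≢l   | yes refl = adj-l m Sm m≢l
  ... | no m≢l   | no m'≢l = clique m m' Sm Sm' m≢m'

  isCliqueᵇ≡cliqueOnᵇ : ∀ K → isCliqueᵇ G K ≡ cliqueOnᵇ (λ _ → true) K
  isCliqueᵇ≡cliqueOnᵇ K = and-concatMap _ (allFin r)

  delete : (Fin r → Bool) → Fin r → Fin r → Bool
  delete S l m = S m ∧ not ⌊ m Fin.≟ l ⌋

  delete-self : ∀ S l → delete S l l ≡ false
  delete-self S l rewrite ⌊≟⌋-diag l = ∧-zeroʳ (S l)

  delete-⊆ : ∀ S l m → delete S l m ≡ true → S m ≡ true
  delete-⊆ S l m = proj₁ ∘ ∧-true⁻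

  delete-∌ : ∀ S l m → delete S l m ≡ true → m ≢ l
  delete-∌ S l m S∖l-m refl = false≢true (trans (sym (delete-self S m)) S∖l-m)

  ⊆-insert-delete : ∀ S l m → S m ≡ true → insert (delete S l) l m ≡ true
  ⊆-insert-delete S l m Sm with m Fin.≟ l
  ... | yes _ = refl
  ... | no _ = trans (∧-identityʳ (S m)) Sm

  cliqueOnᵇ-antitone : ∀ S S' K → (∀ m → S' m ≡ true → S m ≡ true) →
    cliqueOnᵇ S K ≡ true → cliqueOnᵇ S' K ≡ true
  cliqueOnᵇ-antitone S S' K S'⊆S = cliqueOnᵇ⇐ S' K ∘ CliqueOn-mono K S'⊆S ∘ cliqueOnᵇ⇒ S K

  cliqueOnᵇ-update⇒delete : ∀ S l K x → cliqueOnᵇ S (K [ l ]≔ x) ≡ true → cliqueOnᵇ (delete S l) K ≡ true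
  cliqueOnᵇ-update⇒delete S l K x clique = trans (sym (cliqueOnᵇ-ignores (delete S l) l (delete-self S l) K x))
    (cliqueOnᵇ-antitone S (delete S l) (K [ l ]≔ x) (delete-⊆ S l) clique)

  adjacentToᵇ : (Fin r → Bool) → Transversal r n → Vertex r n → Bool
  adjacentToᵇ S K v = all (λ m → not (S m) ∨ adj G (m , K m) v) (allFin r)

  adjacentToᵇ⇒ : ∀ S K v → adjacentToᵇ S K v ≡ true → ∀ m → S m ≡ true → adj G (m , K m) v ≡ true
  adjacentToᵇ⇒ S K v adjacent m Sm = ∨-true⁻ (all-allFin⁻ _ adjacent m) (cong not Sm)

  adjacentToᵇ-cong : ∀ S {K K'} v → (∀ m → S m ≡ true → K m ≡ K' m) → adjacentToᵇ S K v ≡ adjacentToᵇ S K' v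
  adjacentToᵇ-cong S v K≡K'-on-S = all-cong (allFin r) λ m →
    guarded-cong (S m) λ Sm → cong (λ u → adj G (m , u) v) (K≡K'-on-S m Sm)

  cliqueOnᵇ-extend : ∀ S l K x → cliqueOnᵇ (delete S l) K ≡ true → adjacentToᵇ (delete S l) K (l , x) ≡ true →
    cliqueOnᵇ S (K [ l ]≔ x) ≡ true
  cliqueOnᵇ-extend S l K x clique adjacent = cliqueOnᵇ⇐ S K' (CliqueOn-mono K' (⊆-insert-delete S l)
    (CliqueOn-insert (delete S l) l K' (cliqueOnᵇ⇒ (delete S l) K' clique') adjacent'))
    where
    K' = K [ l ]≔ x
    clique' : cliqueOnᵇ (delete S l) K' ≡ true
    clique' = trans (cliqueOnᵇ-ignores (delete S l) l (delete-self S l) K x) clique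
    adjacent' : ∀ m → delete S l m ≡ true → m ≢ l → adj G (m , K' m) (l , K' l) ≡ true
    adjacent' m S∖l-m m≢l = subst₂ (λ u v → adj G (m , u) (l , v) ≡ true)
      (sym (updateAt-minimal m l K m≢l)) (sym (updateAt-updates l K))
      (adjacentToᵇ⇒ (delete S l) K (l , x) adjacent m S∖l-m)

module Counting {r n : ℕ} (G : RPartiteGraph r n) (minDegree : MinPartiteDegree≥ G)
  {{r≢0 : ℕ.NonZero r}} {{n≢0 : ℕ.NonZero n}} where

  open PartialCliques G

  transversals : List (Transversal r n)
  transversals = allFuns r n

  #cliqueOn : (Fin r → Bool) → ℕ
  #cliqueOn S = count (cliqueOnᵇ S) transversals

  nonDegree : Vertex r n → Fin r → ℕ
  nonDegree v l = count (λ y → not (adj G v (l , y))) (allFin n)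

  nonDegree-bound : ∀ v l → part v ≢ l → 16 * r * nonDegree v l ≤ n
  nonDegree-bound v l v∉l = ℕP.+-cancelʳ-≤ ((R ∸ 1) * n) (R * nonDegree v l) n (begin
    R * nonDegree v l + (R ∸ 1) * n   ≤⟨ ℕP.+-monoʳ-≤ (R * nonDegree v l) (minDegree v l v∉l) ⟩
    R * nonDegree v l + R * deg G v l ≡⟨ ℕP.*-distribˡ-+ R _ _ ⟨
    R * (nonDegree v l + deg G v l)   ≡⟨ cong (R *_) (trans (ℕP.+-comm _ (deg G v l)) all-y) ⟩
    R * n                             ≡⟨ cong (_* n) (ℕP.m+[n∸m]≡n 1≤R) ⟨
    n + (R ∸ 1) * n                   ∎)
    where
    open ℕP.≤-Reasoning
    R = 16 * r
    1≤R : 1 ≤ R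
    1≤R = ℕP.≤-trans (ℕ.>-nonZero⁻¹ r) (ℕP.m≤n*m r 16)
    all-y : deg G v l + nonDegree v l ≡ n
    all-y = trans (count-+-count-not (λ y → adj G v (l , y)) (allFin n)) (length-allFin n)

  count-nonadjacent : ∀ S l w → part w ≢ l →
    16 * r * count (λ K → cliqueOnᵇ S K ∧ not (adj G (l , K l) w)) transversals ≤ #cliqueOn (delete S l)
  count-nonadjacent S l w w∉l = ℕP.*-cancelˡ-≤ n (begin
    n * (R * count F transversals)                         ≡⟨ *-leftComm n R _ ⟩
    R * (n * count F transversals)                         ≡⟨ cong (R *_) (count-resample l F F-ext) ⟨
    R * sumℕ (λ K → count (λ x → F (K [ l ]≔ x)) (allFin n)) transversals
                                                           ≡⟨ sumℕ-*ˡ R _ transversals ⟨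
    sumℕ (λ K → R * count (λ x → F (K [ l ]≔ x)) (allFin n)) transversals
                                                           ≤⟨ sumℕ-mono transversals per-transversal ⟩
    sumℕ (λ K → ind (cliqueOnᵇ (delete S l) K) * n) transversals
                                                           ≡⟨ count-*ʳ (cliqueOnᵇ (delete S l)) n transversals ⟩
    #cliqueOn (delete S l) * n                             ≡⟨ ℕP.*-comm _ n ⟩
    n * #cliqueOn (delete S l)                             ∎)
    where
    open ℕP.≤-Reasoning
    R = 16 * r
    F : Transversal r n → Bool
    F K = cliqueOnᵇ S K ∧ not (adj G (l , K l) w)
    F-ext : Extensional F
    F-ext K≗K' = cong₂ (λ b u → b ∧ not (adj G (l , u) w)) (cliqueOnᵇ-ext S K≗K') (K≗K' l)
    per-transversal : ∀ K → R * count (λ x → F (K [ l ]≔ x)) (allFin n) ≤ ind (cliqueOnᵇ (delete S l) K) * n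
    per-transversal K with cliqueOnᵇ (delete S l) K in S∖l-clique
    ... | true = begin
      R * count (λ x → F (K [ l ]≔ x)) (allFin n) ≤⟨ ℕP.*-monoʳ-≤ R (count-mono (allFin n) nonadjacent) ⟩
      R * nonDegree w l                           ≤⟨ nonDegree-bound w l w∉l ⟩
      n                                           ≡⟨ ℕP.+-identityʳ n ⟨
      1 * n                                       ∎
      where
      nonadjacent : ∀ x → F (K [ l ]≔ x) ≡ true → not (adj G w (l , x)) ≡ true
      nonadjacent x Fx = subst (λ u → not u ≡ true)
        (trans (cong (λ u → adj G (l , u) w) (updateAt-updates l K)) (symmetric G (l , x) w))
        (proj₂ (∧-true⁻ Fx))
    ... | false = ℕP.≤-trans (ℕP.*-monoʳ-≤ R (ℕP.≤-trans (count-mono (allFin n) impossible)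
                    (ℕP.≤-reflexive (count-false (allFin n))))) (ℕP.≤-reflexive (ℕP.*-zeroʳ R))
      where
      impossible : ∀ x → F (K [ l ]≔ x) ≡ true → false ≡ true
      impossible x Fx = trans (sym S∖l-clique) (cliqueOnᵇ-update⇒delete S l K x (proj₁ (∧-true⁻ Fx)))

  -- Each of the other at most r parts excludes at most n/(16r) choices of K l.
  count-extendable : ∀ S l K → 15 * r * n ≤ 16 * r * count (λ x → adjacentToᵇ (delete S l) K (l , x)) (allFin n)
  count-extendable S l K = ℕP.+-cancelʳ-≤ (r * n) (15 * r * n) (R * extendable) (begin
    15 * r * n + r * n                                      ≡⟨ solve-ℕ (r ∷ n ∷ []) ⟩
    16 * r * n                                              ≡⟨ cong (R *_) all-x ⟨
    R * (extendable + count (not ∘ Ext) (allFin n))         ≡⟨ ℕP.*-distribˡ-+ R extendable _ ⟩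
    R * extendable + R * count (not ∘ Ext) (allFin n)       ≤⟨ ℕP.+-monoʳ-≤ (R * extendable) not-extendable ⟩
    R * extendable + r * n                                  ∎)
    where
    open ℕP.≤-Reasoning
    R = 16 * r
    S' = delete S l
    Ext : Fin n → Bool
    Ext x = adjacentToᵇ S' K (l , x)
    extendable = count Ext (allFin n)
    all-x : extendable + count (not ∘ Ext) (allFin n) ≡ n
    all-x = trans (count-+-count-not Ext (allFin n)) (length-allFin n)
    Missing : Fin r → Fin n → Bool
    Missing m x = not (not (S' m) ∨ adj G (m , K m) (l , x))
    missing-bound : ∀ m → R * count (Missing m) (allFin n) ≤ n
    missing-bound m with S' m in S'm
    ... | true = nonDegree-bound (m , K m) l (delete-∌ S l m S'm)
    ... | false rewrite count-false (allFin n) | ℕP.*-zeroʳ R = z≤n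
    not-extendable : R * count (not ∘ Ext) (allFin n) ≤ r * n
    not-extendable = begin
      R * count (not ∘ Ext) (allFin n)                      ≤⟨ ℕP.*-monoʳ-≤ R (count-not-all (λ _ → true) _ (allFin n) (allFin r)) ⟩
      R * sumℕ (λ m → count (Missing m) (allFin n)) (allFin r) ≤⟨ sumℕ-bound _ R n (allFin r)
                                                                  (All.tabulate λ {m} _ → missing-bound m) ⟩
      length (allFin r) * n                                 ≡⟨ cong (_* n) (length-allFin r) ⟩
      r * n                                                 ∎

  count-extension : ∀ S l → 15 * r * #cliqueOn (delete S l) ≤ 16 * r * #cliqueOn S
  count-extension S l = ℕP.*-cancelˡ-≤ n (begin
    n * (15 * r * #cliqueOn S')                                  ≡⟨ *-rotate n (15 * r) _ ⟩
    #cliqueOn S' * (15 * r * n)                                  ≡⟨ count-*ʳ (cliqueOnᵇ S') _ transversals ⟨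
    sumℕ (λ K → ind (cliqueOnᵇ S' K) * (15 * r * n)) transversals ≤⟨ sumℕ-mono transversals per-transversal ⟩
    sumℕ (λ K → R * count (λ x → cliqueOnᵇ S (K [ l ]≔ x)) (allFin n)) transversals
                                                                 ≡⟨ sumℕ-*ˡ R _ transversals ⟩
    R * sumℕ (λ K → count (λ x → cliqueOnᵇ S (K [ l ]≔ x)) (allFin n)) transversals
                                                                 ≡⟨ cong (R *_) (count-resample l (cliqueOnᵇ S) (cliqueOnᵇ-ext S)) ⟩
    R * (n * #cliqueOn S)                                        ≡⟨ *-leftComm R n _ ⟩
    n * (R * #cliqueOn S)                                        ∎)
    where
    open ℕP.≤-Reasoning
    R = 16 * r
    S' = delete S l
    per-transversal : ∀ K → ind (cliqueOnᵇ S' K) * (15 * r * n) ≤ R * count (λ x → cliqueOnᵇ S (K [ l ]≔ x)) (allFin n)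
    per-transversal K with cliqueOnᵇ S' K in S'-clique
    ... | false = z≤n
    ... | true = begin
      1 * (15 * r * n)                                    ≡⟨ ℕP.*-identityˡ _ ⟩
      15 * r * n                                          ≤⟨ count-extendable S l K ⟩
      R * count (λ x → adjacentToᵇ S' K (l , x)) (allFin n) ≤⟨ ℕP.*-monoʳ-≤ R
                                                               (count-mono (allFin n) λ x → cliqueOnᵇ-extend S l K x S'-clique) ⟩
      R * count (λ x → cliqueOnᵇ S (K [ l ]≔ x)) (allFin n) ∎

  count-nonadjacent-rare : ∀ S l w → part w ≢ l →
    15 * r * count (λ K → cliqueOnᵇ S K ∧ not (adj G (l , K l) w)) transversals ≤ #cliqueOn S
  count-nonadjacent-rare S l w w∉l = ℕP.*-cancelˡ-≤ (16 * r) {{ℕP.m*n≢0 16 r}} (begin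
    16 * r * (15 * r * nonadjacent)  ≡⟨ *-leftComm (16 * r) (15 * r) _ ⟩
    15 * r * (16 * r * nonadjacent)  ≤⟨ ℕP.*-monoʳ-≤ (15 * r) (count-nonadjacent S l w w∉l) ⟩
    15 * r * #cliqueOn (delete S l)  ≤⟨ count-extension S l ⟩
    16 * r * #cliqueOn S             ∎)
    where
    open ℕP.≤-Reasoning
    nonadjacent = count (λ K → cliqueOnᵇ S K ∧ not (adj G (l , K l) w)) transversals

  count-not-adjacentTo : ∀ S w → S (part w) ≡ false →
    15 * r * count (λ K → cliqueOnᵇ S K ∧ not (adjacentToᵇ S K w)) transversals ≤ r * #cliqueOn S
  count-not-adjacentTo S w S-part-w = begin
    15 * r * count (λ K → cliqueOnᵇ S K ∧ not (adjacentToᵇ S K w)) transversals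
      ≤⟨ ℕP.*-monoʳ-≤ (15 * r) (count-not-all (cliqueOnᵇ S) _ transversals (allFin r)) ⟩
    15 * r * sumℕ (λ m → count (Missing m) transversals) (allFin r)
      ≤⟨ sumℕ-bound _ (15 * r) _ (allFin r) (All.tabulate λ {m} _ → missing-bound m) ⟩
    length (allFin r) * #cliqueOn S
      ≡⟨ cong (_* #cliqueOn S) (length-allFin r) ⟩
    r * #cliqueOn S ∎
    where
    open ℕP.≤-Reasoning
    Missing : Fin r → Transversal r n → Bool
    Missing m K = cliqueOnᵇ S K ∧ not (not (S m) ∨ adj G (m , K m) w)
    missing-bound : ∀ m → 15 * r * count (Missing m) transversals ≤ #cliqueOn S
    missing-bound m with S m in Sm
    ... | true = count-nonadjacent-rare S m w λ { refl → false≢true (trans (sym S-part-w) Sm) }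
    ... | false rewrite count-cong transversals (λ K → ∧-zeroʳ (cliqueOnᵇ S K)) | count-false transversals
                      | ℕP.*-zeroʳ (15 * r) = z≤n

  members : List (Fin r) → Fin r → Bool
  members ls m = any (λ l → ⌊ m Fin.≟ l ⌋) ls

  #cliqueOn-members-pos : ∀ ls → 1 ≤ #cliqueOn (members ls)
  #cliqueOn-members-pos [] = begin
    1                                 ≤⟨ length-allFuns-pos r n (ℕ.>-nonZero⁻¹ n) ⟩
    length transversals               ≡⟨ count-true transversals ⟨
    count (λ _ → true) transversals   ≡⟨ count-cong transversals (λ K → cliqueOnᵇ⇐ (λ _ → false) K λ _ _ ()) ⟨
    #cliqueOn (λ _ → false)           ∎
    where open ℕP.≤-Reasoning
  #cliqueOn-members-pos (l ∷ ls) = 1≤m*n⇒1≤n (16 * r) (begin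
    1                                 ≤⟨ ℕP.*-mono-≤ (ℕP.≤-trans (ℕ.>-nonZero⁻¹ r) (ℕP.m≤n*m r 15)) (#cliqueOn-members-pos ls) ⟩
    15 * r * #cliqueOn (members ls)   ≤⟨ ℕP.*-monoʳ-≤ (15 * r) (count-mono transversals λ K →
                                           cliqueOnᵇ-antitone (members ls) _ K (delete-members ls)) ⟩
    15 * r * #cliqueOn (delete (members (l ∷ ls)) l) ≤⟨ count-extension (members (l ∷ ls)) l ⟩
    16 * r * #cliqueOn (members (l ∷ ls)) ∎)
    where
    open ℕP.≤-Reasoning
    delete-members : ∀ ls m → delete (members (l ∷ ls)) l m ≡ true → members ls m ≡ true
    delete-members ls m with ⌊ m Fin.≟ l ⌋
    ... | true = λ ()
    ... | false = trans (sym (∧-identityʳ _))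

  #cliqueOn-pos : ∀ S → 1 ≤ #cliqueOn S
  #cliqueOn-pos S = ℕP.≤-trans (#cliqueOn-members-pos (allFin r))
    (count-mono transversals λ K → cliqueOnᵇ-antitone (members (allFin r)) S K λ m _ → any-allFin m)

  kr≤#cliqueOn : ∀ S → kr G ≤ #cliqueOn S
  kr≤#cliqueOn S = begin
    kr G                              ≡⟨ length-filter-true (isCliqueᵇ G) transversals ⟩
    count (isCliqueᵇ G) transversals  ≤⟨ count-mono transversals clique⇒cliqueOn ⟩
    #cliqueOn S                       ∎
    where
    open ℕP.≤-Reasoning
    clique⇒cliqueOn : ∀ K → isCliqueᵇ G K ≡ true → cliqueOnᵇ S K ≡ true
    clique⇒cliqueOn K isClique = cliqueOnᵇ-antitone (λ _ → true) S K (λ _ _ → refl)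
      (trans (sym (isCliqueᵇ≡cliqueOnᵇ K)) isClique)

-- Rational weights

toℚᵘ-ℕtoℚ : ∀ m → toℚᵘ (ℕtoℚ m) ≡ ℚᵘ.mkℚᵘ (ℤ.+ m) 0
toℚᵘ-ℕtoℚ m rewrite ℚP.↥p/↧p≡p (mkℚ (ℤ.+ m) 0 (Coprime.sym (1-coprimeTo m))) = refl

ℕtoℚ-+ : ∀ m k → ℕtoℚ (m + k) ≡ ℕtoℚ m ℚ.+ ℕtoℚ k
ℕtoℚ-+ m k = ℚP.toℚᵘ-injective (begin-equality
  toℚᵘ (ℕtoℚ (m + k))                              ≡⟨ toℚᵘ-ℕtoℚ (m + k) ⟩
  ℚᵘ.mkℚᵘ (ℤ.+ (m + k)) 0                          ≃⟨ ℚᵘ.*≡* (cong (ℤ._* ℤ.+ 1) (trans (ℤP.pos-+ m k)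
                                                      (sym (cong₂ ℤ._+_ (ℤP.*-identityʳ (ℤ.+ m)) (ℤP.*-identityʳ (ℤ.+ k)))))) ⟩
  ℚᵘ.mkℚᵘ (ℤ.+ m) 0 ℚᵘ.+ ℚᵘ.mkℚᵘ (ℤ.+ k) 0         ≡⟨ cong₂ ℚᵘ._+_ (toℚᵘ-ℕtoℚ m) (toℚᵘ-ℕtoℚ k) ⟨
  toℚᵘ (ℕtoℚ m) ℚᵘ.+ toℚᵘ (ℕtoℚ k)                 ≃⟨ ℚP.toℚᵘ-homo-+ (ℕtoℚ m) (ℕtoℚ k) ⟨
  toℚᵘ (ℕtoℚ m ℚ.+ ℕtoℚ k)                         ∎)
  where open ℚᵘP.≤-Reasoning

ℕtoℚ-* : ∀ m k → ℕtoℚ (m * k) ≡ ℕtoℚ m ℚ.* ℕtoℚ k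
ℕtoℚ-* m k = ℚP.toℚᵘ-injective (begin-equality
  toℚᵘ (ℕtoℚ (m * k))                              ≡⟨ toℚᵘ-ℕtoℚ (m * k) ⟩
  ℚᵘ.mkℚᵘ (ℤ.+ (m * k)) 0                          ≃⟨ ℚᵘ.*≡* (cong (ℤ._* ℤ.+ 1) (ℤP.pos-* m k)) ⟩
  ℚᵘ.mkℚᵘ (ℤ.+ m) 0 ℚᵘ.* ℚᵘ.mkℚᵘ (ℤ.+ k) 0         ≡⟨ cong₂ ℚᵘ._*_ (toℚᵘ-ℕtoℚ m) (toℚᵘ-ℕtoℚ k) ⟨
  toℚᵘ (ℕtoℚ m) ℚᵘ.* toℚᵘ (ℕtoℚ k)                 ≃⟨ ℚP.toℚᵘ-homo-* (ℕtoℚ m) (ℕtoℚ k) ⟨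
  toℚᵘ (ℕtoℚ m ℚ.* ℕtoℚ k)                         ∎)
  where open ℚᵘP.≤-Reasoning

1/suc : ℕ → ℚ
1/suc k = mkℚ (ℤ.+ 1) k (1-coprimeTo (suc k))

1/suc-inverse : ∀ k → 1/suc k ℚ.* ℕtoℚ (suc k) ≡ 1ℚ
1/suc-inverse k = ℚP.toℚᵘ-injective (begin-equality
  toℚᵘ (1/suc k ℚ.* ℕtoℚ (suc k))                       ≃⟨ ℚP.toℚᵘ-homo-* (1/suc k) (ℕtoℚ (suc k)) ⟩
  ℚᵘ.mkℚᵘ (ℤ.+ 1) k ℚᵘ.* toℚᵘ (ℕtoℚ (suc k))             ≡⟨ cong (ℚᵘ.mkℚᵘ (ℤ.+ 1) k ℚᵘ.*_) (toℚᵘ-ℕtoℚ (suc k)) ⟩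
  ℚᵘ.mkℚᵘ (ℤ.+ 1) k ℚᵘ.* ℚᵘ.mkℚᵘ (ℤ.+ suc k) 0          ≃⟨ ℚᵘ.*≡* (ℤP.*-assoc (ℤ.+ 1) (ℤ.+ suc k) (ℤ.+ 1)) ⟩
  toℚᵘ 1ℚ                                               ∎)
  where open ℚᵘP.≤-Reasoning

ℕtoℚ-mono-≤ : ∀ {m k} → m ≤ k → ℕtoℚ m ℚ.≤ ℕtoℚ k
ℕtoℚ-mono-≤ {m} {k} m≤k = ℚP.toℚᵘ-cancel-≤ (subst₂ ℚᵘ._≤_ (sym (toℚᵘ-ℕtoℚ m)) (sym (toℚᵘ-ℕtoℚ k))
  (ℚᵘ.*≤* (ℤP.*-monoʳ-≤-nonNeg (ℤ.+ 1) (ℤ.+≤+ m≤k))))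

indℚ : Bool → ℚ
indℚ true = 1ℚ
indℚ false = 0ℚ

indℚ≡ℕtoℚ∘ind : ∀ b → indℚ b ≡ ℕtoℚ (ind b)
indℚ≡ℕtoℚ∘ind true = refl
indℚ≡ℕtoℚ∘ind false = refl

if-zero : ∀ b {x : ℚ} → x ≡ 0ℚ → (if b then x else 0ℚ) ≡ 0ℚ
if-zero true x≡0 = x≡0
if-zero false _ = refl

module _ {A : Set} where

  sumℚ-cong : {f g : A → ℚ} (xs : List A) → f ≗ g → sumℚ f xs ≡ sumℚ g xs
  sumℚ-cong [] f≗g = refl
  sumℚ-cong (x ∷ xs) f≗g = cong₂ ℚ._+_ (f≗g x) (sumℚ-cong xs f≗g)

  sumℚ-ℕtoℚ : (f : A → ℕ) (xs : List A) → sumℚ (ℕtoℚ ∘ f) xs ≡ ℕtoℚ (sumℕ f xs)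
  sumℚ-ℕtoℚ f [] = refl
  sumℚ-ℕtoℚ f (x ∷ xs) = trans (cong (ℕtoℚ (f x) ℚ.+_) (sumℚ-ℕtoℚ f xs)) (sym (ℕtoℚ-+ (f x) _))

  sumℚ-indℚ : (p : A → Bool) (xs : List A) → sumℚ (indℚ ∘ p) xs ≡ ℕtoℚ (count p xs)
  sumℚ-indℚ p xs = trans (sumℚ-cong xs (indℚ≡ℕtoℚ∘ind ∘ p))
    (trans (sumℚ-ℕtoℚ (ind ∘ p) xs) (cong ℕtoℚ (sym (count-as-sumℕ p xs))))

  sumℚ-*ˡ : (c : ℚ) (f : A → ℚ) (xs : List A) → sumℚ (λ x → c ℚ.* f x) xs ≡ c ℚ.* sumℚ f xs
  sumℚ-*ˡ c f [] = sym (ℚP.*-zeroʳ c)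
  sumℚ-*ˡ c f (x ∷ xs) = trans (cong (c ℚ.* f x ℚ.+_) (sumℚ-*ˡ c f xs)) (sym (ℚP.*-distribˡ-+ c (f x) _))

  sumℚ-filter-true : (p : A → Bool) (f : A → ℚ) (xs : List A) → (∀ x → p x ≡ false → f x ≡ 0ℚ) →
    sumℚ f (filter (λ x → Data.Bool._≟_ (p x) true) xs) ≡ sumℚ f xs
  sumℚ-filter-true p f [] f-vanishes = refl
  sumℚ-filter-true p f (x ∷ xs) f-vanishes with p x in px
  ... | true = cong (f x ℚ.+_) (sumℚ-filter-true p f xs f-vanishes)
  ... | false = trans (sumℚ-filter-true p f xs f-vanishes)
                  (sym (trans (cong (ℚ._+ sumℚ f xs) (f-vanishes x px)) (ℚP.+-identityˡ _)))

signOf : Bool → Bool → ℚ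
signOf plus minus = if plus then 1ℚ else if minus then - 1ℚ else 0ℚ

module Alternating {X Y : Set} (a a' : X) (b₁ b₂ : Y) where

  alternating : (X → Y → ℚ) → ℚ
  alternating f = f a b₁ ℚ.+ (- f a b₂ ℚ.+ (- f a' b₁ ℚ.+ f a' b₂))

  alternating-sumℚ : ∀ {A : Set} (f : A → X → Y → ℚ) (xs : List A) →
    sumℚ (λ x → alternating (f x)) xs ≡ alternating (λ α β → sumℚ (λ x → f x α β) xs)
  alternating-sumℚ f [] = refl
  alternating-sumℚ f (x ∷ xs) rewrite alternating-sumℚ f xs =
    solve 8 (λ p q s t p' q' s' t' → (p :+ (:- q :+ (:- s :+ t))) :+ (p' :+ (:- q' :+ (:- s' :+ t')))
                                     := (p :+ p') :+ (:- (q :+ q') :+ (:- (s :+ s') :+ (t :+ t')))) refl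
      (f x a b₁) (f x a b₂) (f x a' b₁) (f x a' b₂) _ _ _ _
    where open ℚ-Solver.+-*-Solver

  alternating-*ʳ : ∀ f c → alternating (λ α β → f α β ℚ.* c) ≡ alternating f ℚ.* c
  alternating-*ʳ f c =
    solve 5 (λ p q s t c → p :* c :+ (:- (q :* c) :+ (:- (s :* c) :+ t :* c)) := (p :+ (:- q :+ (:- s :+ t))) :* c)
      refl (f a b₁) (f a b₂) (f a' b₁) (f a' b₂) c
    where open ℚ-Solver.+-*-Solver

  alternating-constʳ : ∀ f → f a b₁ ≡ f a b₂ → f a' b₁ ≡ f a' b₂ → alternating f ≡ 0ℚ
  alternating-constʳ f fa fa' rewrite fa | fa' =
    solve 2 (λ p s → p :+ (:- p :+ (:- s :+ s)) := con 0ℚ) refl (f a b₂) (f a' b₂)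
    where open ℚ-Solver.+-*-Solver

  alternating-constˡ : ∀ f → f a b₁ ≡ f a' b₁ → f a b₂ ≡ f a' b₂ → alternating f ≡ 0ℚ
  alternating-constˡ f fb₁ fb₂ rewrite fb₁ | fb₂ =
    solve 2 (λ p q → p :+ (:- q :+ (:- p :+ q)) := con 0ℚ) refl (f a' b₁) (f a' b₂)
    where open ℚ-Solver.+-*-Solver

  alternating-indicator : (A : X → Bool) (B : Y → Bool) → A a ∧ A a' ≡ false → B b₁ ∧ B b₂ ≡ false →
    alternating (λ α β → indℚ (A α ∧ B β)) ≡ signOf ((A a ∧ B b₁) ∨ (A a' ∧ B b₂)) ((A a ∧ B b₂) ∨ (A a' ∧ B b₁))
  alternating-indicator A B A-excl B-excl with A a | A a' | B b₁ | B b₂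
  alternating-indicator A B () _ | true | true | _ | _
  alternating-indicator A B _ () | _ | _ | true | true
  ... | true  | false | true  | false = refl
  ... | true  | false | false | true  = refl
  ... | true  | false | false | false = refl
  ... | false | true  | true  | false = refl
  ... | false | true  | false | true  = refl
  ... | false | true  | false | false = refl
  ... | false | false | true  | false = refl
  ... | false | false | false | true  = refl
  ... | false | false | false | false = refl

  alternating-indicator-cases : (A : X → Bool) (B : Y → Bool) → A a ∧ A a' ≡ false → B b₁ ∧ B b₂ ≡ false →
    let v = alternating (λ α β → indℚ (A α ∧ B β)) in
    v ≡ 0ℚ ⊎ (∣ v ∣ ≡ 1ℚ × count (λ b → b) (A a ∷ A a' ∷ B b₁ ∷ B b₂ ∷ []) ≡ 2
              × A a ∨ A a' ≡ true × B b₁ ∨ B b₂ ≡ true)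
  alternating-indicator-cases A B A-excl B-excl with A a | A a' | B b₁ | B b₂
  alternating-indicator-cases A B () _ | true | true | _ | _
  alternating-indicator-cases A B _ () | _ | _ | true | true
  ... | true  | false | true  | false = inj₂ (refl , refl , refl , refl)
  ... | true  | false | false | true  = inj₂ (refl , refl , refl , refl)
  ... | true  | false | false | false = inj₁ refl
  ... | false | true  | true  | false = inj₂ (refl , refl , refl , refl)
  ... | false | true  | false | true  = inj₂ (refl , refl , refl , refl)
  ... | false | true  | false | false = inj₁ refl
  ... | false | false | true  | false = inj₁ refl
  ... | false | false | false | true  = inj₁ refl
  ... | false | false | false | false = inj₁ refl

  alternating-cong : ∀ {f g} → (∀ α β → f α β ≡ g α β) → alternating f ≡ alternating g
  alternating-cong f≡g = cong₂ ℚ._+_ (f≡g a b₁)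
    (cong₂ ℚ._+_ (cong -_ (f≡g a b₂)) (cong₂ ℚ._+_ (cong -_ (f≡g a' b₁)) (f≡g a' b₂)))

  alternating-∧ : (A : X → Bool) (B : Y → Bool) (c : Bool) →
    alternating (λ α β → indℚ (A α ∧ B β ∧ c)) ≡ (if c then alternating (λ α β → indℚ (A α ∧ B β)) else 0ℚ)
  alternating-∧ A B true = alternating-cong λ α β → cong (λ b → indℚ (A α ∧ b)) (∧-identityʳ (B β))
  alternating-∧ A B false = alternating-cong λ α β →
    cong indℚ (trans (cong (A α ∧_) (∧-zeroʳ (B β))) (∧-zeroʳ (A α)))

-- The weighting ψ

module Construction {r n : ℕ} (G : RPartiteGraph r n) (minDegree : MinPartiteDegree≥ G)
  {{r≢0 : ℕ.NonZero r}} {{n≢0 : ℕ.NonZero n}}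
  (i j : Fin r) (a a' b₁ b₂ : Fin n) (i≢j : i ≢ j) (a≢a' : a ≢ a') (b₁≢b₂ : b₁ ≢ b₂)
  (ab₁ : adj G (i , a) (j , b₁) ≡ true) (ab₂ : adj G (i , a) (j , b₂) ≡ true)
  (a'b₁ : adj G (i , a') (j , b₁) ≡ true) (a'b₂ : adj G (i , a') (j , b₂) ≡ true) where

  open PartialCliques G
  open Counting G minDegree
  open Alternating a a' b₁ b₂

  W : List (Vertex r n)
  W = (i , a) ∷ (i , a') ∷ (j , b₁) ∷ (j , b₂) ∷ []

  outside : Fin r → Bool
  outside m = not ⌊ m Fin.≟ i ⌋ ∧ not ⌊ m Fin.≟ j ⌋

  outside-i : outside i ≡ false
  outside-i rewrite ⌊≟⌋-diag i = refl

  outside-j : outside j ≡ false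
  outside-j rewrite ⌊≟⌋-diag j = ∧-zeroʳ _

  adjacentToWᵇ : Transversal r n → Bool
  adjacentToWᵇ K = all (adjacentToᵇ outside K) W

  -- Goodness ignores K i and K j; this is what makes the four pinned counts below equal.
  goodᵇ : Transversal r n → Bool
  goodᵇ K = cliqueOnᵇ outside K ∧ adjacentToWᵇ K

  #good : ℕ
  #good = count goodᵇ transversals

  good-ext : Extensional goodᵇ
  good-ext K≗K' = cong₂ _∧_ (cliqueOnᵇ-ext outside K≗K')
    (all-cong W λ w → adjacentToᵇ-cong outside w λ m _ → K≗K' m)

  good-ignores : ∀ l → outside l ≡ false → Ignores l goodᵇ
  good-ignores l out-l K x = cong₂ _∧_ (cliqueOnᵇ-ignores outside l out-l K x)
    (all-cong W λ w → adjacentToᵇ-cong outside w ([]≔-agrees-on outside l out-l K x))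

  #notAdjacentToW : ℕ
  #notAdjacentToW = count (λ K → cliqueOnᵇ outside K ∧ not (adjacentToWᵇ K)) transversals

  count-not-good : 15 * #notAdjacentToW ≤ 4 * #cliqueOn outside
  count-not-good = ℕP.*-cancelˡ-≤ r (begin
    r * (15 * #notAdjacentToW)   ≡⟨ *-leftComm r 15 _ ⟩
    15 * (r * #notAdjacentToW)   ≡⟨ ℕP.*-assoc 15 r _ ⟨
    15 * r * #notAdjacentToW     ≤⟨ ℕP.*-monoʳ-≤ (15 * r)
                                      (count-not-all (cliqueOnᵇ outside) (adjacentToᵇ outside) transversals W) ⟩
    15 * r * sumℕ missing W      ≤⟨ sumℕ-bound missing (15 * r) _ W
                                      (via-i All.∷ via-i All.∷ via-j All.∷ via-j All.∷ All.[]) ⟩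
    4 * (r * #cliqueOn outside)  ≡⟨ *-leftComm 4 r _ ⟩
    r * (4 * #cliqueOn outside)  ∎)
    where
    open ℕP.≤-Reasoning
    missing : Vertex r n → ℕ
    missing w = count (λ K → cliqueOnᵇ outside K ∧ not (adjacentToᵇ outside K w)) transversals
    via-i : ∀ {x} → 15 * r * missing (i , x) ≤ r * #cliqueOn outside
    via-i = count-not-adjacentTo outside _ outside-i
    via-j : ∀ {y} → 15 * r * missing (j , y) ≤ r * #cliqueOn outside
    via-j = count-not-adjacentTo outside _ outside-j

  #cliqueOn≤2*#good : #cliqueOn outside ≤ 2 * #good
  #cliqueOn≤2*#good = begin
    #cliqueOn outside        ≡⟨ split ⟩
    #good + #notAdjacentToW  ≤⟨ 15b≤4[a+b]⇒a+b≤2a #good _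
                                  (subst (λ c → 15 * #notAdjacentToW ≤ 4 * c) split count-not-good) ⟩
    2 * #good                ∎
    where
    open ℕP.≤-Reasoning
    split = count-∧-split (cliqueOnᵇ outside) adjacentToWᵇ transversals

  pinned : Fin n → Fin n → (Transversal r n → Bool) → Transversal r n → Bool
  pinned α β H K = ⌊ K i Fin.≟ α ⌋ ∧ ⌊ K j Fin.≟ β ⌋ ∧ goodᵇ K ∧ H K

  #pinned : Fin n → Fin n → (Transversal r n → Bool) → ℕ
  #pinned α β H = count (pinned α β H) transversals

  j≢i : j ≢ i
  j≢i = i≢j ∘ sym

  n*#pinned-i : ∀ α β H → Extensional H → Ignores i H →
    n * #pinned α β H ≡ count (λ K → ⌊ K j Fin.≟ β ⌋ ∧ goodᵇ K ∧ H K) transversals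
  n*#pinned-i α β H H-ext H-ign = count-pin i α _
    (λ K≗K' → cong₂ (λ u b → ⌊ u Fin.≟ β ⌋ ∧ b) (K≗K' j) (cong₂ _∧_ (good-ext K≗K') (H-ext K≗K')))
    (λ K x → cong₂ (λ u b → ⌊ u Fin.≟ β ⌋ ∧ b) (updateAt-minimal j i K j≢i)
               (cong₂ _∧_ (good-ignores i outside-i K x) (H-ign K x)))

  n*#pinned-j : ∀ α β H → Extensional H → Ignores j H →
    n * #pinned α β H ≡ count (λ K → ⌊ K i Fin.≟ α ⌋ ∧ goodᵇ K ∧ H K) transversals
  n*#pinned-j α β H H-ext H-ign = trans
    (cong (n *_) (count-cong transversals λ K → ∧-swap ⌊ K i Fin.≟ α ⌋ ⌊ K j Fin.≟ β ⌋ (goodᵇ K ∧ H K)))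
    (count-pin j β _
    (λ K≗K' → cong₂ (λ u b → ⌊ u Fin.≟ α ⌋ ∧ b) (K≗K' i) (cong₂ _∧_ (good-ext K≗K') (H-ext K≗K')))
    (λ K x → cong₂ (λ u b → ⌊ u Fin.≟ α ⌋ ∧ b) (updateAt-minimal i j K i≢j)
               (cong₂ _∧_ (good-ignores j outside-j K x) (H-ign K x))))

  #pinned-constˡ : ∀ α α' β H → Extensional H → Ignores i H → #pinned α β H ≡ #pinned α' β H
  #pinned-constˡ α α' β H H-ext H-ign = ℕP.*-cancelˡ-≡ _ _ n
    (trans (n*#pinned-i α β H H-ext H-ign) (sym (n*#pinned-i α' β H H-ext H-ign)))

  #pinned-constʳ : ∀ α β β' H → Extensional H → Ignores j H → #pinned α β H ≡ #pinned α β' H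
  #pinned-constʳ α β β' H H-ext H-ign = ℕP.*-cancelˡ-≡ _ _ n
    (trans (n*#pinned-j α β H H-ext H-ign) (sym (n*#pinned-j α β' H H-ext H-ign)))

  everywhere : Transversal r n → Bool
  everywhere _ = true

  N : ℕ
  N = #pinned a b₁ everywhere

  #pinned-everywhere : ∀ α β → #pinned α β everywhere ≡ N
  #pinned-everywhere α β = trans (#pinned-constˡ α a β everywhere (λ _ → refl) (λ _ _ → refl))
                                 (#pinned-constʳ a β b₁ everywhere (λ _ → refl) (λ _ _ → refl))

  #good≡n*[n*N] : #good ≡ n * (n * N)
  #good≡n*[n*N] = sym (begin
    n * (n * N)
      ≡⟨ cong (n *_) (n*#pinned-i a b₁ everywhere (λ _ → refl) (λ _ _ → refl)) ⟩
    n * count (λ K → ⌊ K j Fin.≟ b₁ ⌋ ∧ goodᵇ K ∧ true) transversals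
      ≡⟨ count-pin j b₁ _ (cong (_∧ true) ∘ good-ext) (λ K x → cong (_∧ true) (good-ignores j outside-j K x)) ⟩
    count (λ K → goodᵇ K ∧ true) transversals
      ≡⟨ count-cong transversals (∧-identityʳ ∘ goodᵇ) ⟩
    #good ∎)
    where open ≡-Reasoning

  N-pos : 1 ≤ N
  N-pos = 1≤m*n⇒1≤n n (1≤m*n⇒1≤n n (1≤m*n⇒1≤n 2 (begin
    1                  ≤⟨ #cliqueOn-pos outside ⟩
    #cliqueOn outside  ≤⟨ #cliqueOn≤2*#good ⟩
    2 * #good          ≡⟨ cong (2 *_) #good≡n*[n*N] ⟩
    2 * (n * (n * N))  ∎)))
    where open ℕP.≤-Reasoning

  kr≤2*n*n*N : kr G ≤ 2 * n * n * N
  kr≤2*n*n*N = begin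
    kr G               ≤⟨ kr≤#cliqueOn outside ⟩
    #cliqueOn outside  ≤⟨ #cliqueOn≤2*#good ⟩
    2 * #good          ≡⟨ cong (2 *_) #good≡n*[n*N] ⟩
    2 * (n * (n * N))  ≡⟨ trans (ℕP.*-assoc (2 * n) n N) (ℕP.*-assoc 2 n (n * N)) ⟨
    2 * n * n * N      ∎
    where open ℕP.≤-Reasoning

  instance
    N≢0 : ℕ.NonZero N
    N≢0 = ℕ.>-nonZero N-pos

  q : ℚ
  q = 1/suc (ℕ.pred N)

  q*N≡1 : q ℚ.* ℕtoℚ N ≡ 1ℚ
  q*N≡1 = subst (λ m → q ℚ.* ℕtoℚ m ≡ 1ℚ) (ℕP.suc-pred N) (1/suc-inverse (ℕ.pred N))

  sign : Fin n → Fin n → ℚ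
  sign x y = alternating (λ α β → indℚ (⌊ x Fin.≟ α ⌋ ∧ ⌊ y Fin.≟ β ⌋))

  ψ : Transversal r n → ℚ
  ψ K = if goodᵇ K then q ℚ.* sign (K i) (K j) else 0ℚ

  adjacentToW⁻ : ∀ K → adjacentToWᵇ K ≡ true →
    (∀ x → x ≡ a ⊎ x ≡ a' → adjacentToᵇ outside K (i , x) ≡ true) ×
    (∀ y → y ≡ b₁ ⊎ y ≡ b₂ → adjacentToᵇ outside K (j , y) ≡ true)
  adjacentToW⁻ K adjacent = to-i , to-j
    where
    all₁ = ∧-true⁻ adjacent
    all₂ = ∧-true⁻ (proj₂ all₁)
    all₃ = ∧-true⁻ (proj₂ all₂)
    all₄ = ∧-true⁻ (proj₂ all₃)
    to-i : ∀ x → x ≡ a ⊎ x ≡ a' → adjacentToᵇ outside K (i , x) ≡ true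
    to-i x (inj₁ refl) = proj₁ all₁
    to-i x (inj₂ refl) = proj₁ all₂
    to-j : ∀ y → y ≡ b₁ ⊎ y ≡ b₂ → adjacentToᵇ outside K (j , y) ≡ true
    to-j y (inj₁ refl) = proj₁ all₃
    to-j y (inj₂ refl) = proj₁ all₄

  W-edge : ∀ x y → x ≡ a ⊎ x ≡ a' → y ≡ b₁ ⊎ y ≡ b₂ → adj G (i , x) (j , y) ≡ true
  W-edge x y (inj₁ refl) (inj₁ refl) = ab₁
  W-edge x y (inj₁ refl) (inj₂ refl) = ab₂
  W-edge x y (inj₂ refl) (inj₁ refl) = a'b₁
  W-edge x y (inj₂ refl) (inj₂ refl) = a'b₂

  good-clique : ∀ K → goodᵇ K ≡ true → K i ≡ a ⊎ K i ≡ a' → K j ≡ b₁ ⊎ K j ≡ b₂ → isCliqueᵇ G K ≡ true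
  good-clique K good Ki Kj = trans (isCliqueᵇ≡cliqueOnᵇ K) (cliqueOnᵇ⇐ everywhere′ K
    (CliqueOn-mono K covered (CliqueOn-insert (insert outside i) j K
      (CliqueOn-insert outside i K (cliqueOnᵇ⇒ outside K (proj₁ good′)) adj-i) adj-j)))
    where
    everywhere′ : Fin r → Bool
    everywhere′ _ = true
    good′ = ∧-true⁻ good
    to-W = adjacentToW⁻ K (proj₂ good′)
    adj-i : ∀ m → outside m ≡ true → m ≢ i → adj G (m , K m) (i , K i) ≡ true
    adj-i m out-m _ = adjacentToᵇ⇒ outside K (i , K i) (proj₁ to-W (K i) Ki) m out-m
    adj-j : ∀ m → insert outside i m ≡ true → m ≢ j → adj G (m , K m) (j , K j) ≡ true
    adj-j m in-m _ with ∨-true⇒⊎ {⌊ m Fin.≟ i ⌋} in-m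
    ... | inj₁ m≟i with refl ← ⌊≟⌋⇒≡ m≟i = W-edge (K i) (K j) Ki Kj
    ... | inj₂ out-m = adjacentToᵇ⇒ outside K (j , K j) (proj₂ to-W (K j) Kj) m out-m
    covered : ∀ m → true ≡ true → insert (insert outside i) j m ≡ true
    covered m _ with ⌊ m Fin.≟ j ⌋ | ⌊ m Fin.≟ i ⌋
    ... | true  | _     = refl
    ... | false | true  = refl
    ... | false | false = refl

  -- Case analysis goes through a variable g (and [_,_]′ below) rather than `with`: abstracting
  -- goodᵇ K in the goal makes Agda normalise the rational arithmetic in ψ K, which is very costly.
  ψ-cases : ∀ K → ψ K ≡ 0ℚ ⊎ (∣ ψ K ∣ ≡ q × countIn K W ≡ 2 × isCliqueᵇ G K ≡ true)
  ψ-cases K = by-goodness (goodᵇ K) refl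
    where
    s = sign (K i) (K j)
    by-goodness : ∀ g → goodᵇ K ≡ g →
      (if g then q ℚ.* s else 0ℚ) ≡ 0ℚ ⊎ (∣ if g then q ℚ.* s else 0ℚ ∣ ≡ q × countIn K W ≡ 2 × isCliqueᵇ G K ≡ true)
    by-goodness false _ = inj₁ refl
    by-goodness true good = Sum.map (λ s≡0 → trans (cong (q ℚ.*_) s≡0) (ℚP.*-zeroʳ q))
      (λ (∣s∣≡1 , two , Ki , Kj) → ∣q*s∣≡q ∣s∣≡1 , two , good-clique K good (⌊≟⌋∨⌊≟⌋⇒ Ki) (⌊≟⌋∨⌊≟⌋⇒ Kj))
      (alternating-indicator-cases (λ α → ⌊ K i Fin.≟ α ⌋) (λ β → ⌊ K j Fin.≟ β ⌋)
        (⌊≟⌋-exclusive a≢a' (K i)) (⌊≟⌋-exclusive b₁≢b₂ (K j)))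
      where
      ∣q*s∣≡q : ∣ s ∣ ≡ 1ℚ → ∣ q ℚ.* s ∣ ≡ q
      ∣q*s∣≡q ∣s∣≡1 = begin
        ∣ q ℚ.* s ∣        ≡⟨ ℚP.∣p*q∣≡∣p∣*∣q∣ q s ⟩
        ∣ q ∣ ℚ.* ∣ s ∣    ≡⟨ cong₂ ℚ._*_ (ℚP.0≤p⇒∣p∣≡p (ℚP.nonNegative⁻¹ q)) ∣s∣≡1 ⟩
        q ℚ.* 1ℚ           ≡⟨ ℚP.*-identityʳ q ⟩
        q                  ∎
        where open ≡-Reasoning

  ψ-off-clique : ∀ K → isCliqueᵇ G K ≡ false → ψ K ≡ 0ℚ
  ψ-off-clique K not-clique = [ id , (λ (_ , _ , clique) → ⊥-elim (false≢true (trans (sym not-clique) clique))) ]′ (ψ-cases K)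

  sumψ : (Transversal r n → Bool) → ℚ
  sumψ H = sumℚ (λ K → if H K then ψ K else 0ℚ) (cliques G)

  ψ-restricted : ∀ H K → (if H K then ψ K else 0ℚ) ≡ q ℚ.* alternating (λ α β → indℚ (pinned α β H K))
  ψ-restricted H K = trans (by-cases (goodᵇ K) (H K))
    (cong (q ℚ.*_) (sym (alternating-∧ (λ α → ⌊ K i Fin.≟ α ⌋) (λ β → ⌊ K j Fin.≟ β ⌋) (goodᵇ K ∧ H K))))
    where
    by-cases : ∀ g h → (if h then (if g then q ℚ.* sign (K i) (K j) else 0ℚ) else 0ℚ)
                       ≡ q ℚ.* (if g ∧ h then sign (K i) (K j) else 0ℚ)
    by-cases true  true  = refl
    by-cases true  false = sym (ℚP.*-zeroʳ q)
    by-cases false true  = sym (ℚP.*-zeroʳ q)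
    by-cases false false = sym (ℚP.*-zeroʳ q)

  sumψ-pinned : ∀ H → sumψ H ≡ q ℚ.* alternating (λ α β → ℕtoℚ (#pinned α β H))
  sumψ-pinned H = begin
    sumψ H
      ≡⟨ sumℚ-filter-true (isCliqueᵇ G) _ transversals off-clique ⟩
    sumℚ (λ K → if H K then ψ K else 0ℚ) transversals
      ≡⟨ sumℚ-cong transversals (ψ-restricted H) ⟩
    sumℚ (λ K → q ℚ.* alternating (λ α β → indℚ (pinned α β H K))) transversals
      ≡⟨ sumℚ-*ˡ q (λ K → alternating (λ α β → indℚ (pinned α β H K))) transversals ⟩
    q ℚ.* sumℚ (λ K → alternating (λ α β → indℚ (pinned α β H K))) transversals
      ≡⟨ cong (q ℚ.*_) (alternating-sumℚ (λ K α β → indℚ (pinned α β H K)) transversals) ⟩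
    q ℚ.* alternating (λ α β → sumℚ (λ K → indℚ (pinned α β H K)) transversals)
      ≡⟨ cong (q ℚ.*_) (alternating-cong λ α β → sumℚ-indℚ (pinned α β H) transversals) ⟩
    q ℚ.* alternating (λ α β → ℕtoℚ (#pinned α β H)) ∎
    where
    open ≡-Reasoning
    off-clique : ∀ K → isCliqueᵇ G K ≡ false → (if H K then ψ K else 0ℚ) ≡ 0ℚ
    off-clique K not-clique = if-zero (H K) (ψ-off-clique K not-clique)

  sumψ-everywhere : sumψ everywhere ≡ 0ℚ
  sumψ-everywhere = begin
    sumψ everywhere                                          ≡⟨ sumψ-pinned everywhere ⟩
    q ℚ.* alternating #everywhere                            ≡⟨ cong (q ℚ.*_) (alternating-constʳ #everywhere (same a) (same a')) ⟩
    q ℚ.* 0ℚ                                                 ≡⟨ ℚP.*-zeroʳ q ⟩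
    0ℚ                                                       ∎
    where
    open ≡-Reasoning
    #everywhere : Fin n → Fin n → ℚ
    #everywhere α β = ℕtoℚ (#pinned α β everywhere)
    same : ∀ α → ℕtoℚ (#pinned α b₁ everywhere) ≡ ℕtoℚ (#pinned α b₂ everywhere)
    same α = cong ℕtoℚ (trans (#pinned-everywhere α b₁) (sym (#pinned-everywhere α b₂)))

  q*kr≤2*n*n : q ℚ.* ℕtoℚ (kr G) ℚ.≤ ℕtoℚ (2 * n * n)
  q*kr≤2*n*n = begin
    q ℚ.* ℕtoℚ (kr G)                   ≤⟨ ℚP.*-monoˡ-≤-nonNeg q (ℕtoℚ-mono-≤ kr≤2*n*n*N) ⟩
    q ℚ.* ℕtoℚ (2 * n * n * N)          ≡⟨ cong (q ℚ.*_) (ℕtoℚ-* (2 * n * n) N) ⟩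
    q ℚ.* (ℕtoℚ (2 * n * n) ℚ.* ℕtoℚ N) ≡⟨ solve 3 (λ x y z → x :* (y :* z) := y :* (x :* z)) refl q (ℕtoℚ (2 * n * n)) (ℕtoℚ N) ⟩
    ℕtoℚ (2 * n * n) ℚ.* (q ℚ.* ℕtoℚ N) ≡⟨ cong (ℕtoℚ (2 * n * n) ℚ.*_) q*N≡1 ⟩
    ℕtoℚ (2 * n * n) ℚ.* 1ℚ             ≡⟨ ℚP.*-identityʳ _ ⟩
    ℕtoℚ (2 * n * n)                    ∎
    where
    open ℚP.≤-Reasoning
    open ℚ-Solver.+-*-Solver

  ψ-bound : ∀ K → ∣ ψ K ∣ ℚ.* ℕtoℚ (kr G) ℚ.≤ ℕtoℚ (2 * n * n)
  ψ-bound K = [ (λ ψ≡0 → subst (λ x → ∣ x ∣ ℚ.* ℕtoℚ (kr G) ℚ.≤ ℕtoℚ (2 * n * n)) (sym ψ≡0) 0*kr≤2*n*n)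
              , (λ (∣ψ∣≡q , _) → subst (λ x → x ℚ.* ℕtoℚ (kr G) ℚ.≤ ℕtoℚ (2 * n * n)) (sym ∣ψ∣≡q) q*kr≤2*n*n)
              ]′ (ψ-cases K)
    where
    0*kr≤2*n*n : ∣ 0ℚ ∣ ℚ.* ℕtoℚ (kr G) ℚ.≤ ℕtoℚ (2 * n * n)
    0*kr≤2*n*n = ℚP.≤-trans (ℚP.≤-reflexive (ℚP.*-zeroˡ (ℕtoℚ (kr G)))) (ℕtoℚ-mono-≤ {0} {2 * n * n} z≤n)

  ψ-support : ∀ K → countIn K W ≢ 2 → ψ K ≡ 0ℚ
  ψ-support K not-two = [ id , (λ (_ , two , _) → ⊥-elim (not-two two)) ]′ (ψ-cases K)

  onEdge : Vertex r n → Vertex r n → Transversal r n → Bool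
  onEdge x y K = inK K x ∧ inK K y

  onEdge-ext : ∀ x y → Extensional (onEdge x y)
  onEdge-ext (p , u) (p' , u') K≗K' = cong₂ (λ s t → ⌊ s Fin.≟ u ⌋ ∧ ⌊ t Fin.≟ u' ⌋) (K≗K' p) (K≗K' p')

  onEdge-ignores : ∀ {p p' l} u u' → p ≢ l → p' ≢ l → Ignores l (onEdge (p , u) (p' , u'))
  onEdge-ignores {p} {p'} {l} u u' p≢l p'≢l K z =
    cong₂ (λ s t → ⌊ s Fin.≟ u ⌋ ∧ ⌊ t Fin.≟ u' ⌋) (updateAt-minimal p l K p≢l) (updateAt-minimal p' l K p'≢l)

  target : Vertex r n → Vertex r n → ℚ
  target x y = signOf (sameEdge x y (i , a) (j , b₁) ∨ sameEdge x y (i , a') (j , b₂))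
                      (sameEdge x y (i , a) (j , b₂) ∨ sameEdge x y (i , a') (j , b₁))

  target-cong : ∀ x y (f : Fin n → Fin n → Bool) → (∀ α β → sameEdge x y (i , α) (j , β) ≡ f α β) →
    target x y ≡ signOf (f a b₁ ∨ f a' b₂) (f a b₂ ∨ f a' b₁)
  target-cong x y f same = cong₂ signOf (cong₂ _∨_ (same a b₁) (same a' b₂)) (cong₂ _∨_ (same a b₂) (same a' b₁))

  target-comm : ∀ x y → target x y ≡ target y x
  target-comm x y = target-cong x y (λ α β → sameEdge y x (i , α) (j , β)) λ α β → sameEdge-comm (i , α) (j , β)
    where
    sameEdge-comm : ∀ v w → sameEdge x y v w ≡ sameEdge y x v w
    sameEdge-comm v w = trans (∨-comm ((x == v) ∧ (y == w)) ((x == w) ∧ (y == v)))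
      (cong₂ _∨_ (∧-comm (x == w) (y == v)) (∧-comm (x == v) (y == w)))

  sumψ-comm : ∀ x y → sumψ (onEdge x y) ≡ sumψ (onEdge y x)
  sumψ-comm x y = sumℚ-cong (cliques G) λ K → cong (λ b → if b then ψ K else 0ℚ) (∧-comm (inK K x) (inK K y))

  edge-avoiding-j : ∀ {p p'} u u' → p ≢ j → p' ≢ j → sumψ (onEdge (p , u) (p' , u')) ≡ target (p , u) (p' , u')
  edge-avoiding-j {p} {p'} u u' p≢j p'≢j = begin
    sumψ H                                            ≡⟨ sumψ-pinned H ⟩
    q ℚ.* alternating #H                              ≡⟨ cong (q ℚ.*_) (alternating-constʳ #H (same a) (same a')) ⟩
    q ℚ.* 0ℚ                                          ≡⟨ ℚP.*-zeroʳ q ⟩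
    0ℚ                                                ≡⟨ target-cong (p , u) (p' , u') (λ _ _ → false) never ⟨
    target (p , u) (p' , u')                          ∎
    where
    open ≡-Reasoning
    H = onEdge (p , u) (p' , u')
    #H : Fin n → Fin n → ℚ
    #H α β = ℕtoℚ (#pinned α β H)
    same : ∀ α → ℕtoℚ (#pinned α b₁ H) ≡ ℕtoℚ (#pinned α b₂ H)
    same α = cong ℕtoℚ (#pinned-constʳ α b₁ b₂ H (onEdge-ext _ _) (onEdge-ignores u u' p≢j p'≢j))
    never : ∀ α β → sameEdge (p , u) (p' , u') (i , α) (j , β) ≡ false
    never α β rewrite ⌊≟⌋-≢ p≢j | ⌊≟⌋-≢ p'≢j = trans (∨-identityʳ _) (∧-zeroʳ _)

  edge-avoiding-i : ∀ {p p'} u u' → p ≢ i → p' ≢ i → sumψ (onEdge (p , u) (p' , u')) ≡ target (p , u) (p' , u')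
  edge-avoiding-i {p} {p'} u u' p≢i p'≢i = begin
    sumψ H                                            ≡⟨ sumψ-pinned H ⟩
    q ℚ.* alternating #H                              ≡⟨ cong (q ℚ.*_) (alternating-constˡ #H (same b₁) (same b₂)) ⟩
    q ℚ.* 0ℚ                                          ≡⟨ ℚP.*-zeroʳ q ⟩
    0ℚ                                                ≡⟨ target-cong (p , u) (p' , u') (λ _ _ → false) never ⟨
    target (p , u) (p' , u')                          ∎
    where
    open ≡-Reasoning
    H = onEdge (p , u) (p' , u')
    #H : Fin n → Fin n → ℚ
    #H α β = ℕtoℚ (#pinned α β H)
    same : ∀ β → ℕtoℚ (#pinned a β H) ≡ ℕtoℚ (#pinned a' β H)
    same β = cong ℕtoℚ (#pinned-constˡ a a' β H (onEdge-ext _ _) (onEdge-ignores u u' p≢i p'≢i))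
    never : ∀ α β → sameEdge (p , u) (p' , u') (i , α) (j , β) ≡ false
    never α β rewrite ⌊≟⌋-≢ p≢i | ⌊≟⌋-≢ p'≢i = ∧-zeroʳ _

  edge-crossing : ∀ u u' → sumψ (onEdge (i , u) (j , u')) ≡ target (i , u) (j , u')
  edge-crossing u u' = begin
    sumψ H                                                ≡⟨ sumψ-pinned H ⟩
    q ℚ.* alternating (λ α β → ℕtoℚ (#pinned α β H))      ≡⟨ cong (q ℚ.*_) (alternating-cong #pinned-crossing) ⟩
    q ℚ.* alternating (λ α β → indℚ (at α β) ℚ.* ℕtoℚ N)  ≡⟨ cong (q ℚ.*_) (alternating-*ʳ (λ α β → indℚ (at α β)) (ℕtoℚ N)) ⟩
    q ℚ.* (A ℚ.* ℕtoℚ N)                                  ≡⟨ solve 3 (λ x y z → x :* (y :* z) := (x :* z) :* y) refl q A (ℕtoℚ N) ⟩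
    q ℚ.* ℕtoℚ N ℚ.* A                                    ≡⟨ cong (ℚ._* A) q*N≡1 ⟩
    1ℚ ℚ.* A                                              ≡⟨ ℚP.*-identityˡ A ⟩
    A                                                     ≡⟨ alternating-indicator (λ α → ⌊ u Fin.≟ α ⌋) (λ β → ⌊ u' Fin.≟ β ⌋)
                                                               (⌊≟⌋-exclusive a≢a' u) (⌊≟⌋-exclusive b₁≢b₂ u') ⟩
    signOf (at a b₁ ∨ at a' b₂) (at a b₂ ∨ at a' b₁)      ≡⟨ target-cong (i , u) (j , u') at crossing ⟨
    target (i , u) (j , u')                               ∎
    where
    open ≡-Reasoning
    open ℚ-Solver.+-*-Solver
    H = onEdge (i , u) (j , u')
    at : Fin n → Fin n → Bool
    at α β = ⌊ u Fin.≟ α ⌋ ∧ ⌊ u' Fin.≟ β ⌋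
    A = alternating (λ α β → indℚ (at α β))
    crossing : ∀ α β → sameEdge (i , u) (j , u') (i , α) (j , β) ≡ at α β
    crossing α β rewrite ⌊≟⌋-diag i | ⌊≟⌋-diag j | ⌊≟⌋-≢ i≢j = ∨-identityʳ _
    pinned-crossing : ∀ α β K → pinned α β H K ≡ pinned α β everywhere K ∧ at α β
    pinned-crossing α β K with K i Fin.≟ α | K j Fin.≟ β
    ... | no _     | _        = refl
    ... | yes _    | no _     = refl
    ... | yes refl | yes refl = cong₂ _∧_ (sym (∧-identityʳ (goodᵇ K)))
                                  (cong₂ _∧_ (⌊≟⌋-sym (K i) u) (⌊≟⌋-sym (K j) u'))
    #pinned-crossing : ∀ α β → ℕtoℚ (#pinned α β H) ≡ indℚ (at α β) ℚ.* ℕtoℚ N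
    #pinned-crossing α β = begin
      ℕtoℚ (#pinned α β H)                   ≡⟨ cong ℕtoℚ (count-cong transversals (pinned-crossing α β)) ⟩
      ℕtoℚ (count (λ K → pinned α β everywhere K ∧ at α β) transversals)
                                             ≡⟨ cong ℕtoℚ (count-∧-const (pinned α β everywhere) (at α β) transversals) ⟩
      ℕtoℚ (ind (at α β) * #pinned α β everywhere)
                                             ≡⟨ cong (λ m → ℕtoℚ (ind (at α β) * m)) (#pinned-everywhere α β) ⟩
      ℕtoℚ (ind (at α β) * N)                ≡⟨ ℕtoℚ-* (ind (at α β)) N ⟩
      ℕtoℚ (ind (at α β)) ℚ.* ℕtoℚ N         ≡⟨ cong (ℚ._* ℕtoℚ N) (indℚ≡ℕtoℚ∘ind (at α β)) ⟨
      indℚ (at α β) ℚ.* ℕtoℚ N               ∎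

  data Position (p p' : Fin r) : Set where
    avoids-j : p ≢ j → p' ≢ j → Position p p'
    avoids-i : p ≢ i → p' ≢ i → Position p p'
    crosses  : p ≡ i → p' ≡ j → Position p p'
    crosses⁻ : p ≡ j → p' ≡ i → Position p p'

  position : ∀ p p' → p ≢ p' → Position p p'
  position p p' p≢p' with p' Fin.≟ j | p Fin.≟ j
  ... | yes refl | _ with p Fin.≟ i
  ...   | yes p≡i = crosses p≡i refl
  ...   | no p≢i  = avoids-i p≢i j≢i
  position p p' p≢p' | no p'≢j | no p≢j = avoids-j p≢j p'≢j
  position p p' p≢p' | no p'≢j | yes refl with p' Fin.≟ i
  ...   | yes p'≡i = crosses⁻ refl p'≡i
  ...   | no p'≢i  = avoids-i j≢i p'≢i

  sumψ-edge : ∀ x y → adj G x y ≡ true → sumψ (onEdge x y) ≡ target x y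
  sumψ-edge (p , u) (p' , u') xy with position p p' (λ p≡p' → false≢true (trans (sym (partite G _ _ p≡p')) xy))
  ... | avoids-j p≢j p'≢j = edge-avoiding-j u u' p≢j p'≢j
  ... | avoids-i p≢i p'≢i = edge-avoiding-i u u' p≢i p'≢i
  ... | crosses  refl refl = edge-crossing u u'
  ... | crosses⁻ refl refl = trans (sumψ-comm (j , u) (i , u'))
                               (trans (edge-crossing u' u) (target-comm (i , u') (j , u)))

lemma4p3 : (r n : ℕ) → 3 ℕ.≤ r → 16 ℕ.* r ℕ.≤ n →
  (G : RPartiteGraph r n) → MinPartiteDegree≥ G →
  (i j : Fin r) (a a' : Fin n) (b₁ b₂ : Fin n) →
  ¬ (a ≡ a') → ¬ (b₁ ≡ b₂) →
  adj G (i , a) (j , b₁) ≡ true → adj G (i , a) (j , b₂) ≡ true →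
  adj G (i , a') (j , b₁) ≡ true → adj G (i , a') (j , b₂) ≡ true →
  Σ (Transversal r n → ℚ) λ ψ →
    (sumℚ ψ (cliques G) ≡ 0ℚ)
    × (∀ (x y : Vertex r n) → adj G x y ≡ true →
        sumℚ (λ K → if inK K x ∧ inK K y then ψ K else 0ℚ) (cliques G)
          ≡ (if sameEdge x y (i , a) (j , b₁) ∨ sameEdge x y (i , a') (j , b₂) then 1ℚ
             else if sameEdge x y (i , a) (j , b₂) ∨ sameEdge x y (i , a') (j , b₁) then - 1ℚ
             else 0ℚ))
    × (∀ (K : Transversal r n) → IsClique G K →
        (countIn K ((i , a) ∷ (i , a') ∷ (j , b₁) ∷ (j , b₂) ∷ []) ≡ 2 →
           ∣ ψ K ∣ ℚ.* ℕtoℚ (kr G) ℚ.≤ ℕtoℚ (2 ℕ.* n ℕ.* n))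
        × (¬ (countIn K ((i , a) ∷ (i , a') ∷ (j , b₁) ∷ (j , b₂) ∷ []) ≡ 2) → ψ K ≡ 0ℚ))
-- From 3 ≤ r and 16r ≤ n only r, n ≥ 1 is used; the density enters through minDegree.
lemma4p3 r n 3≤r 16r≤n G minDegree i j a a' b₁ b₂ a≢a' b₁≢b₂ ab₁ ab₂ a'b₁ a'b₂ =
  ψ , sumψ-everywhere , sumψ-edge , λ K _ → (λ _ → ψ-bound K) , ψ-support K
  where
  1≤r : 1 ≤ r
  1≤r = ℕP.≤-trans (s≤s z≤n) 3≤r
  instance
    r≢0 : ℕ.NonZero r
    r≢0 = ℕ.>-nonZero 1≤r
    n≢0 : ℕ.NonZero n
    n≢0 = ℕ.>-nonZero (ℕP.≤-trans 1≤r (ℕP.≤-trans (ℕP.m≤n*m r 16) 16r≤n))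
  i≢j : i ≢ j
  i≢j i≡j = false≢true (trans (sym (partite G (i , a) (j , b₁) i≡j)) ab₁)
  open Construction G minDegree i j a a' b₁ b₂ i≢j a≢a' b₁≢b₂ ab₁ ab₂ a'b₁ a'b₂
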